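{- Let $G(A,B)$ be a cubic bipartite graph with bipartition $(A,B)$. Assume that $\partial(X)$ is a nontrivial tight cut of $G$ such that $|A\cap X|=|B\cap X|+1$ and $G/\overline{X}$ is simple. Let $a\in A$, $b\in B$. (i) If $a,b\in X$, then $(a,b)$ is a nice pair of $G/\overline{X}$ if and only if it is a nice pair of $G$. (ii) Assume $G$ is 3-connected, $a\in X$ and $b\in\overline{X}$. If $(a,\overline{x})$ is a nice pair of $G/(\overline{X}\to\overline{x})$ and $(x,b)$ is a nice pair of $G/(X\to x)$, then $(a,b)$ is a nice pair of $G$.
   Context: All graphs are finite and connected. For $\emptyset\ne X\subsetneq V(G)$, $\partial(X)$ is the set of edges with exactly one end in $X$, $\overline X=V(G)\setminus X$; it is nontrivial if both sides have at least 2 vertices. $G/(X\to x)$ denotes the graph obtained by contracting $X$ into a single vertex $x$ (so $G/(\overline{X}\to\overline{x})$ contracts $\overline X$ into $\overline x$); these contractions are bipartite, with $\overline x$ in the class of $B$ and $x$ in the class of $A$. An edge cut $C$ of a matching covered graph is tight if $|C\cap M|=1$ for every perfect matching $M$ (cubic bipartite graphs are matching covered). In a bipartite graph with classes $A,B$, a pair $a\in A$, $b\in B$ is a nice pair if deleting $a$, $b$ and all their neighbours leaves a graph with a perfect matching. -}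

module Defs where

open import Data.Nat using (ℕ; zero; suc; _+_; _≤_; _<_)
open import Data.Bool using (Bool; true; false; not; T; _∧_)
open import Data.Fin using (Fin)
open import Data.List using (List; map; allFin; filterᵇ; length)
open import Data.Nat.ListAction using (sum)
open import Data.Product using (Σ; _×_; _,_)
open import Data.Sum using (_⊎_; inj₁; inj₂)
open import Data.Unit using (⊤; tt)
open import Relation.Nullary using (¬_)
open import Relation.Binary.PropositionalEquality using (_≡_)

-- General finite (multi)graphs: a vertex type and an edge-multiplicity
-- function  E u v = number of edges joining u and v.

record Graph : Set₁ where
  field
    V : Set
    E : V → V → ℕ
open Graph public

Adj : (H : Graph) → V H → V H → Set
Adj H u v = 0 < E H u v

-- A perfect matching of the subgraph of H induced by the vertex set S,
-- given as a fixed-point-free involution on S pairing adjacent vertices.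
-- (Existence of a perfect matching only depends on adjacency.)
record PerfectMatchingOn (H : Graph) (S : V H → Set) : Set where
  field
    mate      : V H → V H
    mate-in   : ∀ v → S v → S (mate v)
    mate-inv  : ∀ v → S v → mate (mate v) ≡ v
    mate-ne   : ∀ v → S v → ¬ (mate v ≡ v)
    mate-adj  : ∀ v → S v → Adj H v (mate v)

Remaining : (H : Graph) → V H → V H → V H → Set
Remaining H a b v = ¬ (v ≡ a) × ¬ (v ≡ b) × ¬ Adj H a v × ¬ Adj H b v

-- (a , b) is a nice pair of H  (a ∈ A, b ∈ B is imposed separately)
NicePair : (H : Graph) → V H → V H → Set
NicePair H a b = PerfectMatchingOn H (Remaining H a b)

ΣFin : (n : ℕ) → (Fin n → ℕ) → ℕ
ΣFin n f = sum (map f (allFin n))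

count : (n : ℕ) → (Fin n → Bool) → ℕ
count n p = length (filterᵇ p (allFin n))

FinGraph : (n : ℕ) → (Fin n → Fin n → ℕ) → Graph
FinGraph n E = record { V = Fin n ; E = E }

data Reach {n : ℕ} (E : Fin n → Fin n → ℕ) (S : Fin n → Set) :
           Fin n → Fin n → Set where
  here : ∀ {u} → Reach E S u u
  step : ∀ {u v w} → S v → 0 < E u v → Reach E S v w → Reach E S u w

ConnectedOn : {n : ℕ} → (Fin n → Fin n → ℕ) → (Fin n → Set) → Set
ConnectedOn {n} E S = ∀ u v → S u → S v → Reach E S u v

Connected : {n : ℕ} → (Fin n → Fin n → ℕ) → Set
Connected E = ConnectedOn E (λ _ → ⊤)

ThreeConnected : {n : ℕ} → (Fin n → Fin n → ℕ) → Set
ThreeConnected {n} E =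
  4 ≤ n × Connected E ×
  (∀ (p q : Fin n) → ConnectedOn E (λ v → ¬ (v ≡ p) × ¬ (v ≡ q)))

-- A connected cubic bipartite (multi)graph on Fin n with bipartition
-- given by  side v = true  (v ∈ A),  side v = false  (v ∈ B).
record CubicBipartite (n : ℕ) : Set where
  field
    E         : Fin n → Fin n → ℕ
    side      : Fin n → Bool
    symmetric : ∀ u v → E u v ≡ E v u
    bipartite : ∀ u v → 0 < E u v → ¬ (side u ≡ side v)
    cubic     : ∀ v → ΣFin n (E v) ≡ 3
    connected : Connected E

graphOf : {n : ℕ} → CubicBipartite n → Graph
graphOf {n} G = FinGraph n (CubicBipartite.E G)

-- Contraction.  contractKeep E K : the set {v | K v = false} is shrunk
-- to a single new vertex (inj₂ tt); vertices with K v = true are kept.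
-- So  G/(X̄ → x̄) = contractKeep E X  and  G/(X → x) = contractKeep E (not ∘ X).
-- Loops created by the contraction are discarded (irrelevant for matchings).

edgesInto : {n : ℕ} → (Fin n → Fin n → ℕ) → (Fin n → Bool) → Fin n → ℕ
edgesInto {n} E Y u = ΣFin n (λ w → if-then (Y w) (E u w))
  where
  if-then : Bool → ℕ → ℕ
  if-then true  k = k
  if-then false _ = 0

CVert : (n : ℕ) → (Fin n → Bool) → Set
CVert n K = Σ (Fin n) (λ v → T (K v)) ⊎ ⊤

contractKeep : {n : ℕ} → (Fin n → Fin n → ℕ) → (Fin n → Bool) → Graph
contractKeep {n} E K = record { V = CVert n K ; E = CE }
  where
  CE : CVert n K → CVert n K → ℕ
  CE (inj₁ (u , _)) (inj₁ (v , _)) = E u v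
  CE (inj₁ (u , _)) (inj₂ _)       = edgesInto E (λ w → not (K w)) u
  CE (inj₂ _)       (inj₁ (v , _)) = edgesInto E (λ w → not (K w)) v
  CE (inj₂ _)       (inj₂ _)       = 0

cv : {n : ℕ} {K : Fin n → Bool} → CVert n K
cv = inj₂ tt

kv : {n : ℕ} {K : Fin n → Bool} → (v : Fin n) → T (K v) → CVert n K
kv v p = inj₁ (v , p)

cutMatched : {n : ℕ} → (Fin n → Bool) → (Fin n → Fin n) → ℕ
cutMatched {n} X m = count n (λ v → X v ∧ not (X (m v)))

TightCut : {n : ℕ} → CubicBipartite n → (Fin n → Bool) → Set
TightCut {n} G X =
  (M : PerfectMatchingOn (graphOf G) (λ _ → ⊤)) →
  cutMatched X (PerfectMatchingOn.mate M) ≡ 1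

Nontrivial : (n : ℕ) → (Fin n → Bool) → Set
Nontrivial n X = 2 ≤ count n X × 2 ≤ count n (λ v → not (X v))

-- G/(X̄ → x̄) is simple (no parallel edges; no loops by construction)
ContractionSimple : {n : ℕ} → (Fin n → Fin n → ℕ) → (Fin n → Bool) → Set
ContractionSimple {n} E X =
  (∀ u v → T (X u) → T (X v) → E u v ≤ 1) ×
  (∀ u → T (X u) → edgesInto E (λ w → not (X w)) u ≤ 1)

-- Every edge of a cubic bipartite graph lies in a perfect matching: Hall's condition for
-- G − u − w follows by counting the edges leaving a set of A-vertices.  Along a perfect
-- matching M the A- and B-vertices of X matched inside X pair up, so |A ∩ X| − |B ∩ X| is
-- the number of A-vertices of X matched out of X minus the number of such B-vertices.  As
-- ∂(X) is tight and |A ∩ X| = |B ∩ X| + 1, the unique edge of M in ∂(X) leaves X from A.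
-- Hence every edge of ∂(X) has its X-end in A, |∂(X)| = 3, and X̄ minus the far end of any
-- cut edge has a perfect matching.
--
-- (i) Restricted to X, a perfect matching of G − a − b − N(a) − N(b) has by the same count
-- exactly 1 − |∂(a)| vertices matched out of X; sending that one edge to x̄ gives a matching
-- of the contraction.  Conversely a matching of the contraction is kept on X and completed
-- by a perfect matching of X̄ minus the far end w of the cut edge at a, or, if a has no cut
-- edge, of the cut edge uw at the partner u of x̄.
--
-- (ii) In a 3-connected G every vertex of X̄ has at most one neighbour in X (otherwise two
-- vertices of X̄ would separate X from the rest of X̄).  So the cut edges avoiding the
-- deleted vertices form a matching, and together with the two given matchings of the
-- contractions they cover G − a − b − N(a) − N(b).

module Submission where

open import Defs hiding (E)
open import Data.Nat using (ℕ; zero; suc; _+_; _*_; _≤_; _<_; z≤n; s≤s; z<s; _≤?_; _<?_)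
import Data.Nat as ℕ
open import Data.Nat.Properties hiding (_≟_)
open import Data.Bool using (Bool; true; false; not; T; _∧_)
open import Data.Bool.Properties using (T-irrelevant; not-involutive)
open import Data.Fin using (Fin; zero; suc; _≟_)
open import Data.Fin.Properties using (any?)
open import Data.Fin.Permutation using (permutation)
open import Data.Fin.Subset using (Subset)
open import Data.Fin.Subset.Properties using (anySubset?)
import Data.List as List
open import Data.List.Properties using (map-tabulate)
import Data.Nat.ListAction as ListAction
open import Data.Vec using (lookup; tabulate)
open import Data.Vec.Properties using (lookup∘tabulate)
open import Data.Product using (Σ; ∃; ∃₂; _×_; _,_; proj₁; proj₂; swap)
open import Data.Sum using (_⊎_; inj₁; inj₂; [_,_]′)
open import Data.Unit using (tt)
open import Data.Empty using (⊥-elim)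
import Data.Empty as Empty
open import Function using (_∘_; id)
open import Function.Bundles using (_⇔_; mk⇔; Equivalence)
open import Relation.Nullary using (¬_; Dec; does; yes; no; ¬?)
open import Relation.Nullary.Decidable using (T?; _×-dec_; ⌊_⌋; toWitness; fromWitness)
open import Relation.Unary using (Pred; Decidable; U; _⊆_; _≐_; _∪_; _∩_; _⊥_; ∁; ｛_｝)
open import Relation.Unary.Properties using (U?; _∩?_; _∪?_; ∁?; does-≐)
open import Relation.Binary.Definitions using (DecidableEquality)
open import Relation.Binary.PropositionalEquality
open import Level using (0ℓ)
open import Algebra.Properties.CommutativeSemigroup +-commutativeSemigroup using (xy∙z≈xz∙y)
open import Algebra.Properties.CommutativeSemigroup *-commutativeSemigroup
  using () renaming (x∙yz≈y∙xz to x*yz≈y*xz)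
open import Algebra.Properties.Semiring.Sum +-*-semiring
  using (sum; sum-syntax; sum-cong-≗; sum-replicate-zero; ∑-distrib-+; ∑-comm; sum-permute;
         *-distribˡ-sum; *-distribʳ-sum)

ind : Bool → ℕ
ind true  = 1
ind false = 0

ind-yes : {P : Set} (P? : Dec P) → P → ind (does P?) ≡ 1
ind-yes (yes _) _ = refl
ind-yes (no ¬p) p = ⊥-elim (¬p p)

ind-no : {P : Set} (P? : Dec P) → ¬ P → ind (does P?) ≡ 0
ind-no (yes p) ¬p = ⊥-elim (¬p p)
ind-no (no _)  _  = refl

ind≤1 : ∀ x → ind x ≤ 1
ind≤1 true  = ≤-refl
ind≤1 false = z≤n

ind-mono : {P Q : Set} (P? : Dec P) (Q? : Dec Q) → (P → Q) → ind (does P?) ≤ ind (does Q?)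
ind-mono (no _)  _       _   = z≤n
ind-mono (yes _) (yes _) _   = ≤-refl
ind-mono (yes p) (no ¬q) P→Q = ⊥-elim (¬q (P→Q p))

ind-pos : ∀ k → k ≤ 1 → ind (does (0 <? k)) ≡ k
ind-pos zero          _ = refl
ind-pos (suc zero)    _ = refl
ind-pos (suc (suc k)) (s≤s ())

does-⇔ : {P Q : Set} (P? : Dec P) (Q? : Dec Q) → (P → Q) → (Q → P) → does P? ≡ does Q?
does-⇔ (yes _) (yes _) _   _   = refl
does-⇔ (no  _) (no  _) _   _   = refl
does-⇔ (yes p) (no ¬q) P→Q _   = ⊥-elim (¬q (P→Q p))
does-⇔ (no ¬p) (yes q) _   Q→P = ⊥-elim (¬p (Q→P q))

⟦_⟧ : {A : Set} → (A → Bool) → Pred A 0ℓ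
⟦ p ⟧ x = T (p x)

T-not⇒¬T : ∀ {x} → T (not x) → ¬ T x
T-not⇒¬T {true} ()

¬T⇒T-not : ∀ {x} → ¬ T x → T (not x)
¬T⇒T-not {true}  ¬x = ¬x _
¬T⇒T-not {false} _  = _

T⇒¬T-not : ∀ {x} → T x → ¬ T (not x)
T⇒¬T-not {true} _ ()

¬T-not⇒T : ∀ {x} → ¬ T (not x) → T x
¬T-not⇒T {true}  _   = _
¬T-not⇒T {false} ¬nx = ¬nx _

∑-mono-≤ : ∀ {n} {f g : Fin n → ℕ} → (∀ i → f i ≤ g i) → sum f ≤ sum g
∑-mono-≤ {zero}  f≤g = z≤n
∑-mono-≤ {suc n} f≤g = +-mono-≤ (f≤g zero) (∑-mono-≤ (f≤g ∘ suc))

term≤∑ : ∀ {n} (f : Fin n → ℕ) i → f i ≤ sum f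
term≤∑ f zero    = m≤m+n (f zero) _
term≤∑ f (suc i) = ≤-trans (term≤∑ (f ∘ suc) i) (m≤n+m _ (f zero))

two-terms≤∑ : ∀ {n} (f : Fin n → ℕ) {i j} → ¬ i ≡ j → f i + f j ≤ sum f
two-terms≤∑ f {zero}  {zero}  i≢j = ⊥-elim (i≢j refl)
two-terms≤∑ f {zero}  {suc j} _   = +-monoʳ-≤ (f zero) (term≤∑ (f ∘ suc) j)
two-terms≤∑ f {suc i} {zero}  _   =
  subst (_≤ sum f) (+-comm (f zero) (f (suc i))) (+-monoʳ-≤ (f zero) (term≤∑ (f ∘ suc) i))
two-terms≤∑ f {suc i} {suc j} i≢j =
  ≤-trans (two-terms≤∑ (f ∘ suc) (i≢j ∘ cong suc)) (m≤n+m _ (f zero))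

∑-pos⇒∃ : ∀ {n} (f : Fin n → ℕ) → 0 < sum f → ∃ λ i → 0 < f i
∑-pos⇒∃ {suc n} f ∑>0 with f zero in eq
... | suc _ = zero , subst (0 <_) (sym eq) (s≤s z≤n)
... | zero  = let i , fi>0 = ∑-pos⇒∃ (f ∘ suc) ∑>0 in suc i , fi>0

∑-involution : ∀ {n} (f : Fin n → ℕ) (m : Fin n → Fin n) → (∀ i → m (m i) ≡ i) →
               sum (f ∘ m) ≡ sum f
∑-involution f m inv = sym (sum-permute f (permutation m m inv inv))

ΣFin≡∑ : ∀ n (f : Fin n → ℕ) → ΣFin n f ≡ sum f
ΣFin≡∑ n f = trans (cong ListAction.sum (map-tabulate id f)) (go f)
  where
  go : ∀ {m} (g : Fin m → ℕ) → ListAction.sum (List.tabulate g) ≡ sum g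
  go {zero}  g = refl
  go {suc m} g = cong (g zero +_) (go (g ∘ suc))

sumOver : {n : ℕ} {P : Pred (Fin n) 0ℓ} → Decidable P → (Fin n → ℕ) → ℕ
sumOver {n} P? f = ∑[ i < n ] (ind (does (P? i)) * f i)

card : {n : ℕ} {P : Pred (Fin n) 0ℓ} → Decidable P → ℕ
card P? = sumOver P? (λ _ → 1)

count≡card : ∀ n (p : Fin n → Bool) → count n p ≡ card (T? ∘ p)
count≡card n p = go id
  where
  go : ∀ {m} (g : Fin m → Fin n) →
       List.length (List.filterᵇ p (List.tabulate g)) ≡ sum (λ i → ind (p (g i)) * 1)
  go {zero}  g = refl
  go {suc m} g with p (g zero)
  ... | true  = cong suc (go (g ∘ suc))
  ... | false = go (g ∘ suc)

module _ {n : ℕ} {P : Pred (Fin n) 0ℓ} (P? : Decidable P) where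

  sumOver-cong : {f g : Fin n → ℕ} → (∀ {i} → P i → f i ≡ g i) → sumOver P? f ≡ sumOver P? g
  sumOver-cong {f} {g} f≡g = sum-cong-≗ λ i → pointwise (P? i)
    where
    pointwise : ∀ {i} (d : Dec (P i)) → ind (does d) * f i ≡ ind (does d) * g i
    pointwise (yes p) = cong (_+ 0) (f≡g p)
    pointwise (no  _) = refl

  sumOver-mono : {f g : Fin n → ℕ} → (∀ {i} → P i → f i ≤ g i) → sumOver P? f ≤ sumOver P? g
  sumOver-mono {f} {g} f≤g = ∑-mono-≤ λ i → pointwise (P? i)
    where
    pointwise : ∀ {i} (d : Dec (P i)) → ind (does d) * f i ≤ ind (does d) * g i
    pointwise (yes p) = +-monoˡ-≤ 0 (f≤g p)
    pointwise (no  _) = z≤n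

  sumOver≤∑ : (f : Fin n → ℕ) → sumOver P? f ≤ sum f
  sumOver≤∑ f = ∑-mono-≤ λ i →
    ≤-trans (*-monoˡ-≤ (f i) (ind≤1 (does (P? i)))) (≤-reflexive (*-identityˡ (f i)))

  sumOver-pos⇒∃ : (f : Fin n → ℕ) → 0 < sumOver P? f → ∃ λ i → P i × 0 < f i
  sumOver-pos⇒∃ f sum>0 = let i , term>0 = ∑-pos⇒∃ (λ i → ind (does (P? i)) * f i) sum>0
                          in i , witness (P? i) term>0
    where
    witness : ∀ {i} (d : Dec (P i)) → 0 < ind (does d) * f i → P i × 0 < f i
    witness (yes p) term>0 = p , subst (0 <_) (+-identityʳ _) term>0

  sumOver-+ : (f g : Fin n → ℕ) → sumOver P? (λ i → f i + g i) ≡ sumOver P? f + sumOver P? g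
  sumOver-+ f g = trans (sum-cong-≗ λ i → *-distribˡ-+ (ind (does (P? i))) (f i) (g i))
                        (∑-distrib-+ (λ i → ind (does (P? i)) * f i) (λ i → ind (does (P? i)) * g i))

  sumOver-const : ∀ k → sumOver P? (λ _ → k) ≡ card P? * k
  sumOver-const k = begin
    ∑[ i < n ] (ind (does (P? i)) * k)
      ≡⟨ sum-cong-≗ (λ i → cong (_* k) (*-identityʳ (ind (does (P? i))))) ⟨
    ∑[ i < n ] (ind (does (P? i)) * 1 * k)    ≡⟨ *-distribʳ-sum k (λ i → ind (does (P? i)) * 1) ⟨
    card P? * k                               ∎
    where open ≡-Reasoning

  sumOver-∅ : (∀ {i} → ¬ P i) → (f : Fin n → ℕ) → sumOver P? f ≡ 0
  sumOver-∅ empty f = trans (sum-cong-≗ λ i → cong (_* f i) (ind-no (P? i) empty)) (sum-replicate-zero n)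

  ∑-split : (f : Fin n → ℕ) → sum f ≡ sumOver P? f + sumOver (∁? P?) f
  ∑-split f = trans (sum-cong-≗ λ i → split (does (P? i)) (f i))
                    (∑-distrib-+ (λ i → ind (does (P? i)) * f i) (λ i → ind (does (∁? P? i)) * f i))
    where
    split : ∀ x k → k ≡ ind x * k + ind (not x) * k
    split true  k = sym (trans (+-identityʳ (k + 0)) (+-identityʳ k))
    split false k = sym (+-identityʳ k)

  module _ (f : Fin n → ℕ) where

    private
      weight : ∀ {i} → P i → ind (does (P? i)) * f i ≡ f i
      weight {i} p = trans (cong (_* f i) (ind-yes (P? i) p)) (*-identityˡ (f i))

    term≤sumOver : ∀ {i} → P i → f i ≤ sumOver P? f
    term≤sumOver {i} p = subst (_≤ sumOver P? f) (weight p) (term≤∑ (λ i → ind (does (P? i)) * f i) i)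

    two-terms≤sumOver : ∀ {i j} → ¬ i ≡ j → P i → P j → f i + f j ≤ sumOver P? f
    two-terms≤sumOver i≢j pi pj =
      subst (_≤ sumOver P? f) (cong₂ _+_ (weight pi) (weight pj))
            (two-terms≤∑ (λ i → ind (does (P? i)) * f i) i≢j)

    sumOver≤1⇒unique : sumOver P? f ≤ 1 → ∀ {i j} → P i → P j → 0 < f i → 0 < f j → i ≡ j
    sumOver≤1⇒unique ≤1 {i} {j} pi pj fi>0 fj>0 with i ≟ j
    ... | yes i≡j = i≡j
    ... | no  i≢j =
      ⊥-elim (2≰1 (≤-trans (+-mono-≤ fi>0 fj>0) (≤-trans (two-terms≤sumOver i≢j pi pj) ≤1)))
      where
      2≰1 : ¬ 2 ≤ 1
      2≰1 (s≤s ())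

module _ {n : ℕ} {P Q : Pred (Fin n) 0ℓ} (P? : Decidable P) (Q? : Decidable Q) where

  sumOver-≐ : P ≐ Q → (f : Fin n → ℕ) → sumOver P? f ≡ sumOver Q? f
  sumOver-≐ P≐Q f = sum-cong-≗ λ i → cong (λ x → ind x * f i) (does-≐ P≐Q P? Q? i)

  sumOver-⊆ : P ⊆ Q → (f : Fin n → ℕ) → sumOver P? f ≤ sumOver Q? f
  sumOver-⊆ P⊆Q f = ∑-mono-≤ λ i → *-monoˡ-≤ (f i) (ind-mono (P? i) (Q? i) P⊆Q)

  sumOver-split : (f : Fin n → ℕ) → sumOver P? f ≡ sumOver (P? ∩? Q?) f + sumOver (P? ∩? ∁? Q?) f
  sumOver-split f = trans (sum-cong-≗ λ i → split (does (P? i)) (does (Q? i)) (f i))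
                          (∑-distrib-+ (λ i → ind (does ((P? ∩? Q?) i)) * f i)
                                       (λ i → ind (does ((P? ∩? ∁? Q?) i)) * f i))
    where
    split : ∀ x y k → ind x * k ≡ ind (x ∧ y) * k + ind (x ∧ not y) * k
    split true  true  k = sym (+-identityʳ _)
    split true  false k = refl
    split false _     k = refl

sumOver-splitˡ : ∀ {n} {P Q : Pred (Fin n) 0ℓ} (P? : Decidable P) (Q? : Decidable Q) (f : Fin n → ℕ) →
                 sumOver P? f ≡ sumOver (Q? ∩? P?) f + sumOver (∁? Q? ∩? P?) f
sumOver-splitˡ P? Q? f = trans (sumOver-split P? Q? f)
  (cong₂ _+_ (sumOver-≐ (P? ∩? Q?) (Q? ∩? P?) (swap , swap) f)
             (sumOver-≐ (P? ∩? ∁? Q?) (∁? Q? ∩? P?) (swap , swap) f))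

sumOver-U : ∀ {n} (f : Fin n → ℕ) → sumOver U? f ≡ sum f
sumOver-U f = sum-cong-≗ λ i → *-identityˡ (f i)

sumOver-｛｝ : ∀ {n} (c : Fin n) (f : Fin n → ℕ) → sumOver (c ≟_) f ≡ f c
sumOver-｛｝ {suc n} zero    f = trans (cong (f zero + 0 +_) (sum-replicate-zero n))
                                      (trans (+-identityʳ _) (+-identityʳ _))
sumOver-｛｝ {suc n} (suc c) f = sumOver-｛｝ c (f ∘ suc)

sumOver-∩｛｝ : ∀ {n} {P : Pred (Fin n) 0ℓ} (P? : Decidable P) (c : Fin n) (f : Fin n → ℕ) →
               sumOver (P? ∩? (c ≟_)) f ≡ ind (does (P? c)) * f c
sumOver-∩｛｝ P? c f = trans (sum-cong-≗ λ i → pointwise (does (P? i)) (does (c ≟ i)) (f i))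
                             (sumOver-｛｝ c (λ i → ind (does (P? i)) * f i))
  where
  pointwise : ∀ x y k → ind (x ∧ y) * k ≡ ind y * (ind x * k)
  pointwise true  true  k = sym (*-identityˡ (1 * k))
  pointwise true  false k = refl
  pointwise false true  k = refl
  pointwise false false k = refl

module _ {n : ℕ} {P : Pred (Fin n) 0ℓ} (P? : Decidable P) where

  card-pos⇒∃ : 0 < card P? → ∃ P
  card-pos⇒∃ card>0 = let i , p , _ = sumOver-pos⇒∃ P? (λ _ → 1) card>0 in i , p

  card≥1 : ∀ {i} → P i → 1 ≤ card P?
  card≥1 = term≤sumOver P? (λ _ → 1)

  card≡0⇒∅ : card P? ≡ 0 → ∀ {i} → ¬ P i
  card≡0⇒∅ card≡0 p = 1≰0 (subst (1 ≤_) card≡0 (card≥1 p))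
    where
    1≰0 : ¬ 1 ≤ 0
    1≰0 ()

  card≤1⇒unique : card P? ≤ 1 → ∀ {i j} → P i → P j → i ≡ j
  card≤1⇒unique card≤1 pi pj = sumOver≤1⇒unique P? (λ _ → 1) card≤1 pi pj (s≤s z≤n) (s≤s z≤n)

  card-split : {Q : Pred (Fin n) 0ℓ} (Q? : Decidable Q) → card P? ≡ card (P? ∩? Q?) + card (P? ∩? ∁? Q?)
  card-split Q? = sumOver-split P? Q? (λ _ → 1)

  card-∩｛｝≤1 : ∀ c → card (P? ∩? (c ≟_)) ≤ 1
  card-∩｛｝≤1 c = ≤-trans (≤-reflexive (trans (sumOver-∩｛｝ P? c (λ _ → 1)) (*-identityʳ _)))
                         (ind≤1 (does (P? c)))

  card-splitˡ : {Q : Pred (Fin n) 0ℓ} (Q? : Decidable Q) → card P? ≡ card (Q? ∩? P?) + card (∁? Q? ∩? P?)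
  card-splitˡ Q? = sumOver-splitˡ P? Q? (λ _ → 1)

  card-remove : ∀ {c} → P c → card P? ≡ suc (card (P? ∩? ∁? (c ≟_)))
  card-remove {c} pc = trans (card-split (c ≟_)) (cong (_+ card (P? ∩? ∁? (c ≟_))) only-c)
    where
    only-c : card (P? ∩? (c ≟_)) ≡ 1
    only-c = trans (sumOver-∩｛｝ P? c (λ _ → 1)) (cong (_* 1) (ind-yes (P? c) pc))

card-≐ : ∀ {n} {P Q : Pred (Fin n) 0ℓ} (P? : Decidable P) (Q? : Decidable Q) → P ≐ Q → card P? ≡ card Q?
card-≐ P? Q? P≐Q = sumOver-≐ P? Q? P≐Q (λ _ → 1)

card-mono : ∀ {n} {P Q : Pred (Fin n) 0ℓ} (P? : Decidable P) (Q? : Decidable Q) →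
            P ⊆ Q → card P? ≤ card Q?
card-mono P? Q? P⊆Q = sumOver-⊆ P? Q? P⊆Q (λ _ → 1)

card-｛｝ : ∀ {n} (c : Fin n) → card (c ≟_) ≡ 1
card-｛｝ c = sumOver-｛｝ c (λ _ → 1)

card-｛｝∪ : ∀ {n} (c : Fin n) {N : Pred (Fin n) 0ℓ} (N? : Decidable N) →
             card ((c ≟_) ∪? N?) ≡ card N? + ind (does (∁? N? c))
card-｛｝∪ c {N} N? = trans (card-split ((c ≟_) ∪? N?) N?) (cong₂ _+_
  (card-≐ (((c ≟_) ∪? N?) ∩? N?) N? (proj₂ , λ x → inj₂ x , x))
  (trans (card-≐ (((c ≟_) ∪? N?) ∩? ∁? N?) (∁? N? ∩? (c ≟_))
                 (to , λ (¬x , c≡) → inj₁ c≡ , ¬x))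
         (trans (sumOver-∩｛｝ (∁? N?) c (λ _ → 1)) (*-identityʳ _))))
  where
  to : ∀ {i} → ((｛ c ｝ ∪ N) ∩ ∁ N) i → (∁ N ∩ ｛ c ｝) i
  to (inj₁ c≡ , ¬x) = ¬x , c≡
  to (inj₂ x  , ¬x) = ⊥-elim (¬x x)

module _ {H : Graph} where
  open PerfectMatchingOn

  matching-≐ : {S S′ : Pred (V H) 0ℓ} → S ≐ S′ → PerfectMatchingOn H S → PerfectMatchingOn H S′
  matching-≐ (S⊆S′ , S′⊆S) M = record
    { mate     = mate M
    ; mate-in  = λ v s → S⊆S′ (mate-in M v (S′⊆S s))
    ; mate-inv = λ v s → mate-inv M v (S′⊆S s)
    ; mate-ne  = λ v s → mate-ne M v (S′⊆S s)
    ; mate-adj = λ v s → mate-adj M v (S′⊆S s)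
    }

  restrict : {S S′ : Pred (V H) 0ℓ} (M : PerfectMatchingOn H S) →
             S′ ⊆ S → (∀ {v} → S′ v → S′ (mate M v)) → PerfectMatchingOn H S′
  restrict M S′⊆S closed = record
    { mate     = mate M
    ; mate-in  = λ v s → closed s
    ; mate-inv = λ v s → mate-inv M v (S′⊆S s)
    ; mate-ne  = λ v s → mate-ne M v (S′⊆S s)
    ; mate-adj = λ v s → mate-adj M v (S′⊆S s)
    }

  mate-back : {S : Pred (V H) 0ℓ} (M : PerfectMatchingOn H S) {u w : V H} →
              S u → mate M u ≡ w → mate M w ≡ u
  mate-back M Su refl = mate-inv M _ Su

  matching-∅ : {S : Pred (V H) 0ℓ} → (∀ v → ¬ S v) → PerfectMatchingOn H S
  matching-∅ empty = record
    { mate     = id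
    ; mate-in  = λ v s → ⊥-elim (empty v s)
    ; mate-inv = λ v s → ⊥-elim (empty v s)
    ; mate-ne  = λ v s → ⊥-elim (empty v s)
    ; mate-adj = λ v s → ⊥-elim (empty v s)
    }

  module _ {S₁ S₂ : Pred (V H) 0ℓ} (S₁? : Decidable S₁) (S₁⊥S₂ : S₁ ⊥ S₂)
           (M₁ : PerfectMatchingOn H S₁) (M₂ : PerfectMatchingOn H S₂) where

    private
      m : V H → V H
      m v with S₁? v
      ... | yes _ = mate M₁ v
      ... | no  _ = mate M₂ v

    union-mate₁ : ∀ {v} → S₁ v → m v ≡ mate M₁ v
    union-mate₁ {v} s with S₁? v
    ... | yes _  = refl
    ... | no  ¬s = ⊥-elim (¬s s)

    union-mate₂ : ∀ {v} → S₂ v → m v ≡ mate M₂ v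
    union-mate₂ {v} s with S₁? v
    ... | yes s₁ = ⊥-elim (S₁⊥S₂ (s₁ , s))
    ... | no  _  = refl

    union : PerfectMatchingOn H (S₁ ∪ S₂)
    union = record { mate = m ; mate-in = m-in ; mate-inv = m-inv ; mate-ne = m-ne ; mate-adj = m-adj }
      where
      m-in : ∀ v → (S₁ ∪ S₂) v → (S₁ ∪ S₂) (m v)
      m-in v (inj₁ s) = inj₁ (subst S₁ (sym (union-mate₁ s)) (mate-in M₁ v s))
      m-in v (inj₂ s) = inj₂ (subst S₂ (sym (union-mate₂ s)) (mate-in M₂ v s))
      m-inv : ∀ v → (S₁ ∪ S₂) v → m (m v) ≡ v
      m-inv v (inj₁ s) = trans (cong m (union-mate₁ s))
                               (trans (union-mate₁ (mate-in M₁ v s)) (mate-inv M₁ v s))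
      m-inv v (inj₂ s) = trans (cong m (union-mate₂ s))
                               (trans (union-mate₂ (mate-in M₂ v s)) (mate-inv M₂ v s))
      m-ne : ∀ v → (S₁ ∪ S₂) v → ¬ m v ≡ v
      m-ne v (inj₁ s) = mate-ne M₁ v s ∘ trans (sym (union-mate₁ s))
      m-ne v (inj₂ s) = mate-ne M₂ v s ∘ trans (sym (union-mate₂ s))
      m-adj : ∀ v → (S₁ ∪ S₂) v → Adj H v (m v)
      m-adj v (inj₁ s) = subst (Adj H v) (sym (union-mate₁ s)) (mate-adj M₁ v s)
      m-adj v (inj₂ s) = subst (Adj H v) (sym (union-mate₂ s)) (mate-adj M₂ v s)

  edgeMatching : DecidableEquality (V H) → ∀ {u w} → ¬ u ≡ w → Adj H u w → Adj H w u →
                 PerfectMatchingOn H (｛ u ｝ ∪ ｛ w ｝)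
  edgeMatching _≟_ {u} {w} u≢w uw wu = record
    { mate = m ; mate-in = m-in ; mate-inv = m-inv ; mate-ne = m-ne ; mate-adj = m-adj }
    where
    m : V H → V H
    m v with u ≟ v
    ... | yes _ = w
    ... | no  _ = u
    m-u : m u ≡ w
    m-u with u ≟ u
    ... | yes _   = refl
    ... | no  u≢u = ⊥-elim (u≢u refl)
    m-w : m w ≡ u
    m-w with u ≟ w
    ... | yes u≡w = ⊥-elim (u≢w u≡w)
    ... | no  _   = refl
    m-in : ∀ v → (｛ u ｝ ∪ ｛ w ｝) v → (｛ u ｝ ∪ ｛ w ｝) (m v)
    m-in _ (inj₁ refl) = inj₂ (sym m-u)
    m-in _ (inj₂ refl) = inj₁ (sym m-w)
    m-inv : ∀ v → (｛ u ｝ ∪ ｛ w ｝) v → m (m v) ≡ v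
    m-inv _ (inj₁ refl) = trans (cong m m-u) m-w
    m-inv _ (inj₂ refl) = trans (cong m m-w) m-u
    m-ne : ∀ v → (｛ u ｝ ∪ ｛ w ｝) v → ¬ m v ≡ v
    m-ne _ (inj₁ refl) eq = u≢w (sym (trans (sym m-u) eq))
    m-ne _ (inj₂ refl) eq = u≢w (trans (sym m-w) eq)
    m-adj : ∀ v → (｛ u ｝ ∪ ｛ w ｝) v → Adj H v (m v)
    m-adj _ (inj₁ refl) = subst (Adj H u) (sym m-u) uw
    m-adj _ (inj₂ refl) = subst (Adj H w) (sym m-w) wu

-- Hall's theorem

module Hall {n : ℕ} (E : Fin n → Fin n → ℕ) (E-sym : ∀ {u v} → 0 < E u v → 0 < E v u) where

  G : Graph
  G = FinGraph n E

  AdjacentTo : Pred (Fin n) 0ℓ → Pred (Fin n) 0ℓ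
  AdjacentTo S t = ∃ λ s → S s × 0 < E s t

  adjacentTo? : {S : Pred (Fin n) 0ℓ} → Decidable S → Decidable (AdjacentTo S)
  adjacentTo? S? t = any? (λ s → S? s ×-dec 0 <? E s t)

  module _ {P Q : Pred (Fin n) 0ℓ} (P? : Decidable P) (Q? : Decidable Q) where

    Nbrs? : {S : Pred (Fin n) 0ℓ} → Decidable S → Decidable (Q ∩ AdjacentTo (P ∩ S))
    Nbrs? S? = Q? ∩? adjacentTo? (P? ∩? S?)

    HallCondition : Set₁
    HallCondition = ∀ {S} (S? : Decidable S) → card (P? ∩? S?) ≤ card (Nbrs? S?)

    Critical : {S : Pred (Fin n) 0ℓ} → Decidable S → Set
    Critical S? = 0 < card (P? ∩? S?) × card (P? ∩? S?) < card P? × card (Nbrs? S?) ≤ card (P? ∩? S?)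

    critical? : {S : Pred (Fin n) 0ℓ} (S? : Decidable S) → Dec (Critical S?)
    critical? S? = (0 <? _) ×-dec (_ <? _) ×-dec (_ ≤? _)

    critical-≐ : {S S′ : Pred (Fin n) 0ℓ} (S? : Decidable S) (S′? : Decidable S′) →
                 S ≐ S′ → Critical S? → Critical S′?
    critical-≐ S? S′? (S⊆S′ , S′⊆S) (nonempty , proper , tight) =
      subst (0 <_) ∩≡ nonempty , subst (_< card P?) ∩≡ proper , subst₂ _≤_ nbrs≡ ∩≡ tight
      where
      ∩≡ : card (P? ∩? S?) ≡ card (P? ∩? S′?)
      ∩≡ = card-≐ (P? ∩? S?) (P? ∩? S′?)
                  ((λ (p , s) → p , S⊆S′ s) , (λ (p , s) → p , S′⊆S s))
      nbrs≡ : card (Nbrs? S?) ≡ card (Nbrs? S′?)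
      nbrs≡ = card-≐ (Nbrs? S?) (Nbrs? S′?)
        ( (λ (q , s , (p , x) , e) → q , s , (p , S⊆S′ x) , e)
        , (λ (q , s , (p , x) , e) → q , s , (p , S′⊆S x) , e))

  module Split {P Q : Pred (Fin n) 0ℓ} (P? : Decidable P) (Q? : Decidable Q) (P⊥Q : P ⊥ Q)
               (hc : HallCondition P? Q?) {S₀ : Pred (Fin n) 0ℓ} (S₀? : Decidable S₀)
               (crit : Critical P? Q? S₀?) where

    P₁ Q₁ P₂ Q₂ : Pred (Fin n) 0ℓ
    P₁ = P ∩ S₀
    Q₁ = Q ∩ AdjacentTo P₁
    P₂ = P ∩ ∁ S₀
    Q₂ = Q ∩ ∁ Q₁

    P₁? : Decidable P₁
    P₁? = P? ∩? S₀?
    Q₁? : Decidable Q₁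
    Q₁? = Nbrs? P? Q? S₀?
    P₂? : Decidable P₂
    P₂? = P? ∩? ∁? S₀?
    Q₂? : Decidable Q₂
    Q₂? = Q? ∩? ∁? Q₁?

    disjoint₁ : P₁ ⊥ Q₁
    disjoint₁ ((p , _) , (q , _)) = P⊥Q (p , q)

    disjoint₂ : P₂ ⊥ Q₂
    disjoint₂ ((p , _) , (q , _)) = P⊥Q (p , q)

    balanced₁ : card P₁? ≡ card Q₁?
    balanced₁ = ≤-antisym (hc S₀?) (proj₂ (proj₂ crit))

    balanced₂ : card P? ≡ card Q? → card P₂? ≡ card Q₂?
    balanced₂ bal = +-cancelˡ-≡ (card P₁?) (card P₂?) (card Q₂?) (begin
      card P₁? + card P₂?          ≡⟨ card-split P? S₀? ⟨
      card P?                      ≡⟨ bal ⟩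
      card Q?                      ≡⟨ card-split Q? Q₁? ⟩
      card (Q? ∩? Q₁?) + card Q₂?  ≡⟨ cong (_+ card Q₂?) Q₁⊆Q ⟩
      card Q₁? + card Q₂?          ≡⟨ cong (_+ card Q₂?) balanced₁ ⟨
      card P₁? + card Q₂?          ∎)
      where
      open ≡-Reasoning
      Q₁⊆Q : card (Q? ∩? Q₁?) ≡ card Q₁?
      Q₁⊆Q = card-≐ (Q? ∩? Q₁?) Q₁? (proj₂ , λ q₁ → proj₁ q₁ , q₁)

    smaller₁ : card P₁? < card P?
    smaller₁ = proj₁ (proj₂ crit)

    smaller₂ : card P₂? < card P?
    smaller₂ = subst (card P₂? <_) (trans (+-comm (card P₂?) (card P₁?)) (sym (card-split P? S₀?)))
                     (m<m+n (card P₂?) (proj₁ crit))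

    hall₁ : HallCondition P₁? Q₁?
    hall₁ {S} S? = begin
      card (P₁? ∩? S?)               ≡⟨ card-≐ (P₁? ∩? S?) (P? ∩? (S₀? ∩? S?))
                                                (assocʳ , assocˡ) ⟩
      card (P? ∩? (S₀? ∩? S?))       ≤⟨ hc (S₀? ∩? S?) ⟩
      card (Nbrs? P? Q? (S₀? ∩? S?)) ≤⟨ card-mono (Nbrs? P? Q? (S₀? ∩? S?)) (Nbrs? P₁? Q₁? S?)
                                                   inclusion ⟩
      card (Nbrs? P₁? Q₁? S?)        ∎
      where
      open ≤-Reasoning
      assocʳ : ∀ {v} → (P₁ ∩ S) v → (P ∩ (S₀ ∩ S)) v
      assocʳ ((p , s₀) , s) = p , s₀ , s
      assocˡ : ∀ {v} → (P ∩ (S₀ ∩ S)) v → (P₁ ∩ S) v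
      assocˡ (p , s₀ , s) = (p , s₀) , s
      inclusion : ∀ {t} → (Q ∩ AdjacentTo (P ∩ (S₀ ∩ S))) t → (Q₁ ∩ AdjacentTo (P₁ ∩ S)) t
      inclusion (q , s , (p , s₀ , x) , e) = (q , s , (p , s₀) , e) , s , ((p , s₀) , x) , e

    hall₂ : HallCondition P₂? Q₂?
    hall₂ {S} S? = +-cancelˡ-≤ (card P₁?) (card (P₂? ∩? S?)) (card N₂?) (begin
      card P₁? + card (P₂? ∩? S?)              ≡⟨ split ⟨
      card (P? ∩? S′?)                         ≤⟨ hc S′? ⟩
      card N?                                  ≡⟨ card-split N? Q₁? ⟩
      card (N? ∩? Q₁?) + card (N? ∩? ∁? Q₁?)   ≤⟨ +-mono-≤ (card-mono (N? ∩? Q₁?) Q₁? proj₂)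
                                                           (card-mono (N? ∩? ∁? Q₁?) N₂? outside) ⟩
      card Q₁? + card N₂?                      ≡⟨ cong (_+ card N₂?) balanced₁ ⟨
      card P₁? + card N₂?                      ∎)
      where
      open ≤-Reasoning
      S′? : Decidable (S₀ ∪ S)
      S′? = S₀? ∪? S?
      N? : Decidable (Q ∩ AdjacentTo (P ∩ (S₀ ∪ S)))
      N? = Nbrs? P? Q? S′?
      N₂? : Decidable (Q₂ ∩ AdjacentTo (P₂ ∩ S))
      N₂? = Nbrs? P₂? Q₂? S?
      split : card (P? ∩? S′?) ≡ card P₁? + card (P₂? ∩? S?)
      split = trans (card-split (P? ∩? S′?) S₀?)
                    (cong₂ _+_ (card-≐ ((P? ∩? S′?) ∩? S₀?) P₁?
                                       (inside , λ (p , s₀) → (p , inj₁ s₀) , s₀))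
                               (card-≐ ((P? ∩? S′?) ∩? ∁? S₀?) (P₂? ∩? S?) (to , from)))
        where
        inside : ∀ {v} → ((P ∩ (S₀ ∪ S)) ∩ S₀) v → P₁ v
        inside ((p , _) , s₀) = p , s₀
        to : ∀ {v} → ((P ∩ (S₀ ∪ S)) ∩ ∁ S₀) v → (P₂ ∩ S) v
        to ((p , inj₁ s₀) , ¬s₀) = ⊥-elim (¬s₀ s₀)
        to ((p , inj₂ s)  , ¬s₀) = (p , ¬s₀) , s
        from : ∀ {v} → (P₂ ∩ S) v → ((P ∩ (S₀ ∪ S)) ∩ ∁ S₀) v
        from ((p , ¬s₀) , s) = (p , inj₂ s) , ¬s₀
      outside : ∀ {t} → ((Q ∩ AdjacentTo (P ∩ (S₀ ∪ S))) ∩ ∁ Q₁) t →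
                (Q₂ ∩ AdjacentTo (P₂ ∩ S)) t
      outside ((q , s , (p , inj₁ s₀) , e) , ¬q₁) = ⊥-elim (¬q₁ (q , s , (p , s₀) , e))
      outside ((q , s , (p , inj₂ x)  , e) , ¬q₁) =
        (q , ¬q₁) , s , ((p , λ s₀ → ¬q₁ (q , s , (p , s₀) , e)) , x) , e

    combine : PerfectMatchingOn G (P₁ ∪ Q₁) → PerfectMatchingOn G (P₂ ∪ Q₂) →
              PerfectMatchingOn G (P ∪ Q)
    combine M₁ M₂ = matching-≐ (⊆PQ , PQ⊆) (union (P₁? ∪? Q₁?) disjoint M₁ M₂)
      where
      disjoint : (P₁ ∪ Q₁) ⊥ (P₂ ∪ Q₂)
      disjoint (inj₁ (_ , s₀) , inj₁ (_ , ¬s₀)) = ¬s₀ s₀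
      disjoint (inj₁ (p , _)  , inj₂ (q , _))   = P⊥Q (p , q)
      disjoint (inj₂ (q , _)  , inj₁ (p , _))   = P⊥Q (p , q)
      disjoint (inj₂ q₁       , inj₂ (_ , ¬q₁)) = ¬q₁ q₁
      ⊆PQ : (P₁ ∪ Q₁) ∪ (P₂ ∪ Q₂) ⊆ P ∪ Q
      ⊆PQ (inj₁ (inj₁ (p , _))) = inj₁ p
      ⊆PQ (inj₁ (inj₂ (q , _))) = inj₂ q
      ⊆PQ (inj₂ (inj₁ (p , _))) = inj₁ p
      ⊆PQ (inj₂ (inj₂ (q , _))) = inj₂ q
      PQ⊆ : P ∪ Q ⊆ (P₁ ∪ Q₁) ∪ (P₂ ∪ Q₂)
      PQ⊆ {v} (inj₁ p) with S₀? v
      ... | yes s₀ = inj₁ (inj₁ (p , s₀))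
      ... | no ¬s₀ = inj₂ (inj₁ (p , ¬s₀))
      PQ⊆ {v} (inj₂ q) with Q₁? v
      ... | yes q₁ = inj₁ (inj₂ q₁)
      ... | no ¬q₁ = inj₂ (inj₂ (q , ¬q₁))

  module Peel {P Q : Pred (Fin n) 0ℓ} (P? : Decidable P) (Q? : Decidable Q) (P⊥Q : P ⊥ Q)
              (hc : HallCondition P? Q?) (noCritical : ∀ {S} (S? : Decidable S) → ¬ Critical P? Q? S?)
              {p : Fin n} (Pp : P p) where

    partner : ∃ λ q → Q q × 0 < E p q
    partner with card-pos⇒∃ (Nbrs? P? Q? (p ≟_))
                            (≤-trans (card≥1 (P? ∩? (p ≟_)) (Pp , refl)) (hc (p ≟_)))
    ... | q , Qq , _ , (_ , refl) , 0<E = q , Qq , 0<E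

    q : Fin n
    q = proj₁ partner

    Qq : Q q
    Qq = proj₁ (proj₂ partner)

    0<E : 0 < E p q
    0<E = proj₂ (proj₂ partner)

    P′ Q′ : Pred (Fin n) 0ℓ
    P′ = P ∩ ∁ ｛ p ｝
    Q′ = Q ∩ ∁ ｛ q ｝

    P′? : Decidable P′
    P′? = P? ∩? ∁? (p ≟_)
    Q′? : Decidable Q′
    Q′? = Q? ∩? ∁? (q ≟_)

    disjoint′ : P′ ⊥ Q′
    disjoint′ ((p , _) , (q , _)) = P⊥Q (p , q)

    balanced′ : card P? ≡ card Q? → card P′? ≡ card Q′?
    balanced′ bal = suc-injective (trans (sym (card-remove P? Pp)) (trans bal (card-remove Q? Qq)))

    smaller′ : card P′? < card P?
    smaller′ = ≤-reflexive (sym (card-remove P? Pp))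

    hall′ : HallCondition P′? Q′?
    hall′ {S} S? with card (P′? ∩? S?) ℕ.≟ 0
    ... | yes empty = subst (_≤ card N′?) (sym empty) z≤n
      where
      N′? = Nbrs? P′? Q′? S?
    ... | no nonempty = ≤-pred (begin-strict
      card (P′? ∩? S?)                                ≡⟨ reassoc ⟨
      card (P? ∩? S″?)                                <⟨ expanding ⟩
      card N″?                                        ≡⟨ card-split N″? (q ≟_) ⟩
      card (N″? ∩? (q ≟_)) + card (N″? ∩? ∁? (q ≟_))
        ≤⟨ +-mono-≤ (card-∩｛｝≤1 N″? q) (card-mono (N″? ∩? ∁? (q ≟_)) N′? inclusion) ⟩
      1 + card N′?                                    ∎)
      where
      open ≤-Reasoning
      S″? : Decidable (∁ ｛ p ｝ ∩ S)
      S″? = ∁? (p ≟_) ∩? S?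
      N″? : Decidable (Q ∩ AdjacentTo (P ∩ (∁ ｛ p ｝ ∩ S)))
      N″? = Nbrs? P? Q? S″?
      N′? : Decidable (Q′ ∩ AdjacentTo (P′ ∩ S))
      N′? = Nbrs? P′? Q′? S?
      reassoc : card (P? ∩? S″?) ≡ card (P′? ∩? S?)
      reassoc = card-≐ (P? ∩? S″?) (P′? ∩? S?)
                  ((λ (x , ¬p , s) → (x , ¬p) , s) , (λ ((x , ¬p) , s) → x , ¬p , s))
      expanding : card (P? ∩? S″?) < card N″?
      expanding with card N″? ≤? card (P? ∩? S″?)
      ... | no  ≰ = ≰⇒> ≰
      ... | yes ≤ = ⊥-elim (noCritical S″? (nonempty′ , proper , ≤))
        where
        nonempty′ : 0 < card (P? ∩? S″?)
        nonempty′ = subst (0 <_) (sym reassoc) (n≢0⇒n>0 nonempty)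
        proper : card (P? ∩? S″?) < card P?
        proper = begin-strict
          card (P? ∩? S″?) ≡⟨ reassoc ⟩
          card (P′? ∩? S?) ≤⟨ card-mono (P′? ∩? S?) P′? proj₁ ⟩
          card P′?         <⟨ smaller′ ⟩
          card P?          ∎
      inclusion : ∀ {t} → ((Q ∩ AdjacentTo (P ∩ (∁ ｛ p ｝ ∩ S))) ∩ ∁ ｛ q ｝) t →
                  (Q′ ∩ AdjacentTo (P′ ∩ S)) t
      inclusion ((Qt , s , (Ps , ¬p , x) , e) , ¬q) = (Qt , ¬q) , s , ((Ps , ¬p) , x) , e

    combine : PerfectMatchingOn G (P′ ∪ Q′) → PerfectMatchingOn G (P ∪ Q)
    combine M′ = matching-≐ (⊆PQ , PQ⊆) (union ((p ≟_) ∪? (q ≟_)) disjoint pq M′)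
      where
      p≢q : ¬ p ≡ q
      p≢q p≡q = P⊥Q (Pp , subst Q (sym p≡q) Qq)
      pq : PerfectMatchingOn G (｛ p ｝ ∪ ｛ q ｝)
      pq = edgeMatching _≟_ p≢q 0<E (E-sym 0<E)
      disjoint : (｛ p ｝ ∪ ｛ q ｝) ⊥ (P′ ∪ Q′)
      disjoint (inj₁ refl , inj₁ (_ , ¬p))  = ¬p refl
      disjoint (inj₁ refl , inj₂ (Qp , _))  = P⊥Q (Pp , Qp)
      disjoint (inj₂ refl , inj₁ (Pq , _))  = P⊥Q (Pq , Qq)
      disjoint (inj₂ refl , inj₂ (_ , ¬q))  = ¬q refl
      ⊆PQ : (｛ p ｝ ∪ ｛ q ｝) ∪ (P′ ∪ Q′) ⊆ P ∪ Q
      ⊆PQ (inj₁ (inj₁ refl))     = inj₁ Pp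
      ⊆PQ (inj₁ (inj₂ refl))     = inj₂ Qq
      ⊆PQ (inj₂ (inj₁ (Pv , _))) = inj₁ Pv
      ⊆PQ (inj₂ (inj₂ (Qv , _))) = inj₂ Qv
      PQ⊆ : P ∪ Q ⊆ (｛ p ｝ ∪ ｛ q ｝) ∪ (P′ ∪ Q′)
      PQ⊆ {v} (inj₁ Pv) with p ≟ v
      ... | yes p≡v = inj₁ (inj₁ p≡v)
      ... | no  p≢v = inj₂ (inj₁ (Pv , p≢v))
      PQ⊆ {v} (inj₂ Qv) with q ≟ v
      ... | yes q≡v = inj₁ (inj₂ q≡v)
      ... | no  q≢v = inj₂ (inj₂ (Qv , q≢v))

  -- Induction on |P|: split along a critical set, or else match some p ∈ P to a neighbour
  -- q; without critical sets, Hall's condition survives the removal of p and q.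
  hall : ∀ {P Q} (P? : Decidable P) (Q? : Decidable Q) → P ⊥ Q → card P? ≡ card Q? →
         HallCondition P? Q? → PerfectMatchingOn G (P ∪ Q)
  hall P? = go (card P?) P? ≤-refl
    where
    go : ∀ k {P Q} (P? : Decidable P) → card P? ≤ k → (Q? : Decidable Q) → P ⊥ Q →
         card P? ≡ card Q? → HallCondition P? Q? → PerfectMatchingOn G (P ∪ Q)
    go k P? ≤k Q? P⊥Q bal hc with card P? ℕ.≟ 0
    ... | yes empty = matching-∅ λ
      { v (inj₁ Pv) → card≡0⇒∅ P? empty Pv
      ; v (inj₂ Qv) → card≡0⇒∅ Q? (trans (sym bal) empty) Qv }
    go zero    P? ≤k Q? P⊥Q bal hc | no nonempty = ⊥-elim (nonempty (n≤0⇒n≡0 ≤k))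
    go (suc k) {P} {Q} P? ≤k Q? P⊥Q bal hc | no nonempty
      with anySubset? (λ s → critical? P? Q? (T? ∘ lookup s))
    ... | yes (_ , crit) =
      let open Split P? Q? P⊥Q hc _ crit
      in combine (go k P₁? (≤-pred (≤-trans smaller₁ ≤k)) Q₁? disjoint₁ balanced₁ hall₁)
                 (go k P₂? (≤-pred (≤-trans smaller₂ ≤k)) Q₂? disjoint₂ (balanced₂ bal) hall₂)
    ... | no noCrit =
      let open Peel P? Q? P⊥Q hc noCritical (proj₂ (card-pos⇒∃ P? (n≢0⇒n>0 nonempty)))
      in combine (go k P′? (≤-pred (≤-trans smaller′ ≤k)) Q′? disjoint′ (balanced′ bal) hall′)
      where
      noCritical : ∀ {S} (S? : Decidable S) → ¬ Critical P? Q? S?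
      noCritical {S} S? crit = noCrit (s , critical-≐ P? Q? S? (T? ∘ lookup s) (S⊆s , s⊆S) crit)
        where
        s : Subset n
        s = tabulate (λ v → ⌊ S? v ⌋)
        S⊆s : ∀ {v} → S v → T (lookup s v)
        S⊆s {v} Sv = subst T (sym (lookup∘tabulate _ v)) (fromWitness Sv)
        s⊆S : ∀ {v} → T (lookup s v) → S v
        s⊆S {v} sv = toWitness (subst T (lookup∘tabulate _ v) sv)

-- Degrees and double counting

module Degrees {n : ℕ} (E : Fin n → Fin n → ℕ) where

  degIn : {Y : Pred (Fin n) 0ℓ} → Decidable Y → Fin n → ℕ
  degIn Y? v = sumOver Y? (E v)

  edgesInto≡degIn : (Y : Fin n → Bool) (v : Fin n) → edgesInto E Y v ≡ degIn (T? ∘ Y) v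
  edgesInto≡degIn Y v =
    trans (ΣFin≡∑ n _) (sum-cong-≗ λ w → +-cancelʳ-≡ 0 _ _ (exposed (Y w) (E v w)))
    where
    -- The conditional inside edgesInto is local to Defs; a one-vertex instance exposes it.
    exposed : ∀ b k → edgesInto {1} (λ _ _ → k) (λ _ → b) zero ≡ ind b * k + 0
    exposed true  k = cong (_+ 0) (sym (+-identityʳ k))
    exposed false k = refl

  someNbrIn : {Y : Pred (Fin n) 0ℓ} → Decidable Y → Fin n → Fin n
  someNbrIn Y? v with any? (λ w → Y? w ×-dec 0 <? E v w)
  ... | yes (w , _) = w
  ... | no  _       = v

  someNbrIn-spec : {Y : Pred (Fin n) 0ℓ} (Y? : Decidable Y) {v : Fin n} → 0 < degIn Y? v →
                   Y (someNbrIn Y? v) × 0 < E v (someNbrIn Y? v)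
  someNbrIn-spec Y? {v} deg>0 with any? (λ w → Y? w ×-dec 0 <? E v w)
  ... | yes (_ , found) = found
  ... | no  none        = ⊥-elim (none (sumOver-pos⇒∃ Y? (E v) deg>0))

  degIn≡0 : {Y : Pred (Fin n) 0ℓ} (Y? : Decidable Y) {v : Fin n} →
            (∀ {w} → Y w → ¬ 0 < E v w) → degIn Y? v ≡ 0
  degIn≡0 Y? {v} no-edge = n≤0⇒n≡0 (≮⇒≥ λ deg>0 →
    let _ , Yw , vw = sumOver-pos⇒∃ Y? (E v) deg>0 in no-edge Yw vw)

  module _ (E-sym : ∀ u v → E u v ≡ E v u) where

    edges-sym : {S Z : Pred (Fin n) 0ℓ} (S? : Decidable S) (Z? : Decidable Z) →
                sumOver S? (degIn Z?) ≡ sumOver Z? (degIn S?)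
    edges-sym S? Z? = begin
      ∑[ v < n ] (s v * ∑[ w < n ] (z w * E v w))
        ≡⟨ sum-cong-≗ (λ v → *-distribˡ-sum (s v) (λ w → z w * E v w)) ⟩
      ∑[ v < n ] ∑[ w < n ] (s v * (z w * E v w))
        ≡⟨ ∑-comm (λ v w → s v * (z w * E v w)) ⟩
      ∑[ w < n ] ∑[ v < n ] (s v * (z w * E v w))
        ≡⟨ sum-cong-≗ (λ w → sum-cong-≗ (λ v → reorder v w)) ⟩
      ∑[ w < n ] ∑[ v < n ] (z w * (s v * E w v))
        ≡⟨ sum-cong-≗ (λ w → *-distribˡ-sum (z w) (λ v → s v * E w v)) ⟨
      ∑[ w < n ] (z w * ∑[ v < n ] (s v * E w v))
        ∎
      where
      open ≡-Reasoning
      s z : Fin n → ℕ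
      s v = ind (does (S? v))
      z w = ind (does (Z? w))
      reorder : ∀ v w → s v * (z w * E v w) ≡ z w * (s v * E w v)
      reorder v w = trans (x*yz≈y*xz (s v) (z w) (E v w)) (cong (λ e → z w * (s v * e)) (E-sym v w))

  degIn-≐-on-nbrs : {Y Y′ : Pred (Fin n) 0ℓ} (Y? : Decidable Y) (Y′? : Decidable Y′) (v : Fin n) →
                    (∀ {w} → 0 < E v w → Y w → Y′ w) → (∀ {w} → 0 < E v w → Y′ w → Y w) →
                    degIn Y? v ≡ degIn Y′? v
  degIn-≐-on-nbrs Y? Y′? v Y⇒Y′ Y′⇒Y = sum-cong-≗ pointwise
    where
    pointwise : ∀ w → ind (does (Y? w)) * E v w ≡ ind (does (Y′? w)) * E v w
    pointwise w with Y? w | Y′? w | 0 <? E v w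
    ... | yes _ | yes _  | _       = refl
    ... | no  _ | no  _  | _       = refl
    ... | yes y | no ¬y′ | yes 0<E = ⊥-elim (¬y′ (Y⇒Y′ 0<E y))
    ... | no ¬y | yes y′ | yes 0<E = ⊥-elim (¬y (Y′⇒Y 0<E y′))
    ... | yes _ | no _   | no ¬0<E = cong (_+ 0) (n≤0⇒n≡0 (≮⇒≥ ¬0<E))
    ... | no _  | yes _  | no ¬0<E = sym (cong (_+ 0) (n≤0⇒n≡0 (≮⇒≥ ¬0<E)))

m*3≤n*3+2⇒m≤n : ∀ m n → m * 3 ≤ n * 3 + 2 → m ≤ n
m*3≤n*3+2⇒m≤n m n m*3≤n*3+2 = ≤-pred (*-cancelʳ-< 3 m (suc n) (begin-strict
  m * 3       ≤⟨ m*3≤n*3+2 ⟩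
  n * 3 + 2   <⟨ +-monoʳ-< (n * 3) (n<1+n 2) ⟩
  n * 3 + 3   ≡⟨ +-comm (n * 3) 3 ⟩
  suc n * 3   ∎))
  where open ≤-Reasoning

module CubicBipartiteProperties {n : ℕ} (G : CubicBipartite n) where
  open CubicBipartite G
  open Degrees E

  A B : Pred (Fin n) 0ℓ
  A = ⟦ side ⟧
  B = ∁ A

  A? : Decidable A
  A? = T? ∘ side
  B? : Decidable B
  B? = ∁? A?

  degree : ∀ v → sum (E v) ≡ 3
  degree v = trans (sym (ΣFin≡∑ n (E v))) (cubic v)

  degIn≤3 : {Y : Pred (Fin n) 0ℓ} (Y? : Decidable Y) (v : Fin n) → degIn Y? v ≤ 3
  degIn≤3 Y? v = ≤-trans (sumOver≤∑ Y? (E v)) (≤-reflexive (degree v))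

  degIn-U : ∀ v → degIn U? v ≡ 3
  degIn-U v = trans (sumOver-U (E v)) (degree v)

  degIn-split : {Y : Pred (Fin n) 0ℓ} (Y? : Decidable Y) (v : Fin n) → degIn Y? v + degIn (∁? Y?) v ≡ 3
  degIn-split Y? v = trans (sym (∑-split Y? (E v))) (degree v)

  E-sym : ∀ {u v} → 0 < E u v → 0 < E v u
  E-sym {u} {v} = subst (0 <_) (symmetric u v)

  no-loop : ∀ {v} → ¬ 0 < E v v
  no-loop {v} vv = bipartite v v vv refl

  A→B : ∀ {u v} → A u → 0 < E u v → B v
  A→B {u} {v} Au uv Av with side u | side v | bipartite u v uv
  ... | true | true | ≢ = ≢ refl

  B→A : ∀ {u v} → B u → 0 < E u v → A v
  B→A {u} {v} Bu uv with side u | side v | bipartite u v uv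
  ... | true  | _     | _ = ⊥-elim (Bu _)
  ... | false | true  | _ = _
  ... | false | false | ≢ = ⊥-elim (≢ refl)

  bipartite-balance : {Y : Pred (Fin n) 0ℓ} (Y? : Decidable Y) →
                      sumOver (A? ∩? Y?) (degIn Y?) ≡ sumOver (B? ∩? Y?) (degIn Y?)
  bipartite-balance Y? = begin
    sumOver (A? ∩? Y?) (degIn Y?)          ≡⟨ sumOver-cong (A? ∩? Y?) (λ (Av , _) → onlyB Av) ⟩
    sumOver (A? ∩? Y?) (degIn (B? ∩? Y?))  ≡⟨ edges-sym symmetric (A? ∩? Y?) (B? ∩? Y?) ⟩
    sumOver (B? ∩? Y?) (degIn (A? ∩? Y?))  ≡⟨ sumOver-cong (B? ∩? Y?) (λ (Bv , _) → onlyA Bv) ⟨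
    sumOver (B? ∩? Y?) (degIn Y?)          ∎
    where
    open ≡-Reasoning
    onlyB : ∀ {v} → A v → degIn Y? v ≡ degIn (B? ∩? Y?) v
    onlyB Av = degIn-≐-on-nbrs Y? (B? ∩? Y?) _ (λ vw y → A→B Av vw , y) (λ _ → proj₂)
    onlyA : ∀ {v} → B v → degIn Y? v ≡ degIn (A? ∩? Y?) v
    onlyA Bv = degIn-≐-on-nbrs Y? (A? ∩? Y?) _ (λ vw y → B→A Bv vw , y) (λ _ → proj₂)

  balanced : card A? ≡ card B?
  balanced = *-cancelʳ-≡ (card A?) (card B?) 3 (begin
    card A? * 3                      ≡⟨ cong (_* 3) (card-≐ A? (A? ∩? U?) ((_, tt) , proj₁)) ⟩
    card (A? ∩? U?) * 3              ≡⟨ sumOver-const (A? ∩? U?) 3 ⟨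
    sumOver (A? ∩? U?) (λ _ → 3)     ≡⟨ sumOver-cong (A? ∩? U?) (λ _ → sym (degIn-U _)) ⟩
    sumOver (A? ∩? U?) (degIn U?)    ≡⟨ bipartite-balance U? ⟩
    sumOver (B? ∩? U?) (degIn U?)    ≡⟨ sumOver-cong (B? ∩? U?) (λ _ → degIn-U _) ⟩
    sumOver (B? ∩? U?) (λ _ → 3)     ≡⟨ sumOver-const (B? ∩? U?) 3 ⟩
    card (B? ∩? U?) * 3              ≡⟨ cong (_* 3) (card-≐ B? (B? ∩? U?) ((_, tt) , proj₁)) ⟨
    card B? * 3                      ∎)
    where open ≡-Reasoning

  module _ {u w : Fin n} (Au : A u) (uw : 0 < E u w) where
    open Hall E E-sym using (HallCondition; Nbrs?; hall)

    private
      Bw : B w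
      Bw = A→B Au uw

      P Q : Pred (Fin n) 0ℓ
      P = A ∩ ∁ ｛ u ｝
      Q = B ∩ ∁ ｛ w ｝

      P? : Decidable P
      P? = A? ∩? ∁? (u ≟_)
      Q? : Decidable Q
      Q? = B? ∩? ∁? (w ≟_)

      degIn-w : {S : Pred (Fin n) 0ℓ} (S? : Decidable S) → S ⊆ ∁ ｛ u ｝ → degIn S? w ≤ 2
      degIn-w S? S⊆ = +-cancelˡ-≤ 1 (degIn S? w) 2 (begin
        1 + degIn S? w                          ≤⟨ +-mono-≤ wu (sumOver-⊆ S? (∁? (u ≟_)) S⊆ (E w)) ⟩
        degIn (u ≟_) w + degIn (∁? (u ≟_)) w    ≡⟨ ∑-split (u ≟_) (E w) ⟨
        sum (E w)                               ≡⟨ degree w ⟩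
        3                                       ∎)
        where
        open ≤-Reasoning
        wu : 1 ≤ degIn (u ≟_) w
        wu = subst (1 ≤_) (sym (sumOver-｛｝ u (E w))) (E-sym uw)

      -- Each edge leaving S′ ends in N(S′) ∖ {w} or at w, and at most two of them end at w
      -- since the third edge at w comes from u ∉ S′.
      hallCondition : HallCondition P? Q?
      hallCondition S? = m*3≤n*3+2⇒m≤n (card S′?) (card N?) (begin
        card S′? * 3                      ≡⟨ sumOver-const S′? 3 ⟨
        sumOver S′? (λ _ → 3)             ≡⟨ sumOver-cong S′? (λ _ → sym (degIn-U _)) ⟩
        sumOver S′? (degIn U?)            ≡⟨ edges-sym symmetric S′? U? ⟩
        sumOver U? (degIn S′?)            ≤⟨ sumOver-mono U? (λ {t} _ → bound (N? t) (w ≟ t)) ⟩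
        sumOver U? (λ t → ind (does (N? t)) * 3 + ind (does (w ≟ t)) * 2)
          ≡⟨ sumOver-U (λ t → ind (does (N? t)) * 3 + ind (does (w ≟ t)) * 2) ⟩
        ∑[ t < n ] (ind (does (N? t)) * 3 + ind (does (w ≟ t)) * 2)
          ≡⟨ ∑-distrib-+ (λ t → ind (does (N? t)) * 3) (λ t → ind (does (w ≟ t)) * 2) ⟩
        sumOver N? (λ _ → 3) + sumOver (w ≟_) (λ _ → 2)
          ≡⟨ cong₂ _+_ (sumOver-const N? 3) (sumOver-｛｝ w (λ _ → 2)) ⟩
        card N? * 3 + 2                   ∎)
        where
        open ≤-Reasoning
        S′? = P? ∩? S?
        N? = Nbrs? P? Q? S?
        bound : ∀ {t} (N-dec : Dec _) (w-dec : Dec (w ≡ t)) →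
                degIn S′? t ≤ ind (does N-dec) * 3 + ind (does w-dec) * 2
        bound {t} (yes _) _          = ≤-trans (degIn≤3 S′? t) (m≤m+n 3 _)
        bound {t} (no  _) (yes refl) = degIn-w S′? (λ ((_ , ¬u) , _) → ¬u)
        bound {t} (no ¬N) (no  w≢t)  = ≤-reflexive (degIn≡0 S′? λ ((Av , ¬u) , Sv) tv →
                                         ¬N ((A→B Av (E-sym tv) , w≢t) , _ , ((Av , ¬u) , Sv) , E-sym tv))

      u≢w : ¬ u ≡ w
      u≢w refl = Bw Au

      balanced′ : card P? ≡ card Q?
      balanced′ = suc-injective (trans (sym (card-remove A? Au)) (trans balanced (card-remove B? Bw)))

      disjoint : (｛ u ｝ ∪ ｛ w ｝) ⊥ (P ∪ Q)
      disjoint (inj₁ refl , inj₁ (_ , ¬u))  = ¬u refl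
      disjoint (inj₁ refl , inj₂ (Bu , _))  = Bu Au
      disjoint (inj₂ refl , inj₁ (Aw , _))  = Bw Aw
      disjoint (inj₂ refl , inj₂ (_ , ¬w))  = ¬w refl

      pair : PerfectMatchingOn (FinGraph n E) (｛ u ｝ ∪ ｛ w ｝)
      pair = edgeMatching _≟_ u≢w uw (E-sym uw)

      rest : PerfectMatchingOn (FinGraph n E) (P ∪ Q)
      rest = hall P? Q? (λ ((Av , _) , (Bv , _)) → Bv Av) balanced′ hallCondition

    edge-in-perfect-matching : Σ (PerfectMatchingOn (graphOf G) U) (λ M → PerfectMatchingOn.mate M u ≡ w)
    edge-in-perfect-matching = matching-≐ ((λ _ → tt) , everywhere) M , mate-u
      where
      M : PerfectMatchingOn (FinGraph n E) ((｛ u ｝ ∪ ｛ w ｝) ∪ (P ∪ Q))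
      M = union ((u ≟_) ∪? (w ≟_)) disjoint pair rest
      everywhere : U ⊆ (｛ u ｝ ∪ ｛ w ｝) ∪ (P ∪ Q)
      everywhere {v} _ with u ≟ v | w ≟ v | A? v
      ... | yes u≡v | _       | _      = inj₁ (inj₁ u≡v)
      ... | no  _   | yes w≡v | _      = inj₁ (inj₂ w≡v)
      ... | no  u≢v | no  _   | yes Av = inj₂ (inj₁ (Av , u≢v))
      ... | no  _   | no  w≢v | no  Bv = inj₂ (inj₂ (Bv , w≢v))
      mate-u : PerfectMatchingOn.mate M u ≡ w
      mate-u with PerfectMatchingOn.mate-in pair u (inj₁ refl) | PerfectMatchingOn.mate-ne pair u (inj₁ refl)
      ... | inj₁ u≡ | ne = ⊥-elim (ne (sym u≡))
      ... | inj₂ w≡ | _  =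
        trans (union-mate₁ ((u ≟_) ∪? (w ≟_)) disjoint pair rest (inj₁ refl)) (sym w≡)

  Leaving : (Fin n → Fin n) → Pred (Fin n) 0ℓ → Pred (Fin n) 0ℓ
  Leaving m Y v = Y v × ¬ Y (m v)

  leaving? : (m : Fin n → Fin n) {Y : Pred (Fin n) 0ℓ} → Decidable Y → Decidable (Leaving m Y)
  leaving? m Y? v = Y? v ×-dec ¬? (Y? (m v))

  module _ {R : Pred (Fin n) 0ℓ} (R? : Decidable R) (M : PerfectMatchingOn (FinGraph n E) R)
           {Y : Pred (Fin n) 0ℓ} (Y? : Decidable Y) where
    open PerfectMatchingOn M

    private
      involution : Fin n → Fin n
      involution v with R? v
      ... | yes _ = mate v
      ... | no  _ = v

      involution-R : ∀ {v} → R v → involution v ≡ mate v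
      involution-R {v} r with R? v
      ... | yes _ = refl
      ... | no ¬r = ⊥-elim (¬r r)

      involution-¬R : ∀ {v} → ¬ R v → involution v ≡ v
      involution-¬R {v} ¬r with R? v
      ... | yes r = ⊥-elim (¬r r)
      ... | no  _ = refl

      involutive : ∀ v → involution (involution v) ≡ v
      involutive v with R? v
      ... | yes r = trans (involution-R (mate-in v r)) (mate-inv v r)
      ... | no ¬r = involution-¬R ¬r

      Staying : Pred (Fin n) 0ℓ → Pred (Fin n) 0ℓ
      Staying Z v = Z v × R v × Y v × Y (mate v)

      staying? : {Z : Pred (Fin n) 0ℓ} → Decidable Z → Decidable (Staying Z)
      staying? Z? v = Z? v ×-dec R? v ×-dec Y? v ×-dec Y? (mate v)

      -- mate, extended by the identity outside R, is an involution exchanging the A- and the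
      -- B-vertices of R ∩ Y that are matched inside Y.
      staying-balanced : card (staying? A?) ≡ card (staying? B?)
      staying-balanced = begin
        card (staying? A?)              ≡⟨ card-≐ (staying? A?) (swapped? ∘ involution) (to , from) ⟩
        card (swapped? ∘ involution)    ≡⟨ ∑-involution (λ v → ind (does (swapped? v)) * 1)
                                                          involution involutive ⟩
        card swapped?                   ≡⟨ card-≐ swapped? (staying? B?) (to′ , from′) ⟩
        card (staying? B?)                          ∎
        where
        open ≡-Reasoning
        Swapped : Pred (Fin n) 0ℓ
        Swapped v = B v × R v × Y v × Y (involution v)
        swapped? : Decidable Swapped
        swapped? v = B? v ×-dec R? v ×-dec Y? v ×-dec Y? (involution v)
        to : ∀ {v} → Staying A v → Swapped (involution v)
        to {v} (Av , Rv , Yv , Ymv) rewrite involution-R Rv | involution-R (mate-in v Rv) | mate-inv v Rv =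
          A→B Av (mate-adj v Rv) , mate-in v Rv , Ymv , Yv
        from : ∀ {v} → Swapped (involution v) → Staying A v
        from {v} (Bmv , Rmv , Ymv , Ymmv) = cases (R? v) (A? v)
          where
          cases : Dec (R v) → Dec (A v) → Staying A v
          cases (no ¬r) _        = ⊥-elim (¬r (subst R (involution-¬R ¬r) Rmv))
          cases (yes r) (no  Bv) = ⊥-elim (subst B (involution-R r) Bmv (B→A Bv (mate-adj v r)))
          cases (yes r) (yes Av) = Av , r , subst Y (involutive v) Ymmv , subst Y (involution-R r) Ymv
        to′ : ∀ {v} → Swapped v → Staying B v
        to′ (Bv , Rv , Yv , Yiv) = Bv , Rv , Yv , subst Y (involution-R Rv) Yiv
        from′ : ∀ {v} → Staying B v → Swapped v
        from′ (Bv , Rv , Yv , Ymv) = Bv , Rv , Yv , subst Y (sym (involution-R Rv)) Ymv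

      split-by-mate : {Z : Pred (Fin n) 0ℓ} (Z? : Decidable Z) →
                      card (Z? ∩? R? ∩? Y?) ≡ card (staying? Z?) + card (Z? ∩? R? ∩? leaving? mate Y?)
      split-by-mate Z? = trans (card-split (Z? ∩? R? ∩? Y?) (Y? ∘ mate)) (cong₂ _+_
        (card-≐ ((Z? ∩? R? ∩? Y?) ∩? (Y? ∘ mate)) (staying? Z?)
                ((λ ((z , r , y) , y′) → z , r , y , y′) , (λ (z , r , y , y′) → (z , r , y) , y′)))
        (card-≐ ((Z? ∩? R? ∩? Y?) ∩? ∁? (Y? ∘ mate)) (Z? ∩? R? ∩? leaving? mate Y?)
                ((λ ((z , r , y) , ¬y′) → z , r , y , ¬y′) ,
                 (λ (z , r , y , ¬y′) → (z , r , y) , ¬y′))))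

    matching-balance : card (A? ∩? R? ∩? Y?) + card (B? ∩? R? ∩? leaving? mate Y?) ≡
                       card (B? ∩? R? ∩? Y?) + card (A? ∩? R? ∩? leaving? mate Y?)
    matching-balance = begin
      card (A? ∩? R? ∩? Y?) + lB          ≡⟨ cong (_+ lB) (split-by-mate A?) ⟩
      card (staying? A?) + lA + lB        ≡⟨ xy∙z≈xz∙y (card (staying? A?)) lA lB ⟩
      card (staying? A?) + lB + lA        ≡⟨ cong (λ k → k + lB + lA) staying-balanced ⟩
      card (staying? B?) + lB + lA        ≡⟨ cong (_+ lA) (split-by-mate B?) ⟨
      card (B? ∩? R? ∩? Y?) + lA          ∎
      where
      open ≡-Reasoning
      lA = card (A? ∩? R? ∩? leaving? mate Y?)
      lB = card (B? ∩? R? ∩? leaving? mate Y?)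

-- Contracting the complement of a vertex set

module Contraction {n : ℕ} (E : Fin n → Fin n → ℕ) (K : Fin n → Bool) where
  open Degrees E
  open PerfectMatchingOn

  C : Graph
  C = contractKeep E K

  kv-injective : ∀ {v w p q} → kv {K = K} v p ≡ kv w q → v ≡ w
  kv-injective refl = refl

  kv-cong : ∀ {v w p q} → v ≡ w → kv {K = K} v p ≡ kv w q
  kv-cong {p = p} {q} refl = cong (kv _) (T-irrelevant p q)

  kv≢cv : ∀ {v p} → ¬ kv {K = K} v p ≡ cv
  kv≢cv ()

  Adj-cv⇒ : ∀ {v p} → Adj C (kv v p) cv → 0 < degIn (∁? (T? ∘ K)) v
  Adj-cv⇒ {v} = subst (0 <_) (edgesInto≡degIn (not ∘ K) v)

  ⇒Adj-cv : ∀ {v p} → 0 < degIn (∁? (T? ∘ K)) v → Adj C (kv v p) cv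
  ⇒Adj-cv {v} = subst (0 <_) (sym (edgesInto≡degIn (not ∘ K) v))

  Adj-cv⁻ : ∀ {v p} → Adj C (kv v p) cv → ∃ λ w → ¬ T (K w) × 0 < E v w
  Adj-cv⁻ {v} {p} adj = sumOver-pos⇒∃ (∁? (T? ∘ K)) (E v) (Adj-cv⇒ {p = p} adj)

  Adj-cv⁺ : ∀ {v p w} → ¬ T (K w) → 0 < E v w → Adj C (kv v p) cv
  Adj-cv⁺ {v} {p} ¬Kw vw = ⇒Adj-cv {p = p} (≤-trans vw (term≤sumOver (∁? (T? ∘ K)) (E v) ¬Kw))

  module _ {S : Pred (CVert n K) 0ℓ} (M : PerfectMatchingOn C S) where

    Lifted : Pred (Fin n) 0ℓ
    Lifted v = Σ (T (K v)) λ p → S (kv v p) × ¬ mate M (kv v p) ≡ cv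

    mate≢cv : ¬ S cv → ∀ {v p} → S (kv v p) → ¬ mate M (kv v p) ≡ cv
    mate≢cv ¬Scv s mate≡cv = ¬Scv (subst S mate≡cv (mate-in M _ s))

    private
      project : CVert n K → Fin n → Fin n
      project (inj₁ (w , _)) _ = w
      project (inj₂ _)       v = v

      m : Fin n → Fin n
      m v with T? (K v)
      ... | yes p = project (mate M (kv v p)) v
      ... | no  _ = v

      partner : ∀ {v} (p : T (K v)) → ¬ mate M (kv v p) ≡ cv →
                ∃₂ λ w q → mate M (kv v p) ≡ kv w q × m v ≡ w
      partner {v} p ≢cv with mate M (kv v p) in eq
      ... | inj₂ _       = ⊥-elim (≢cv refl)
      ... | inj₁ (w , q) = w , q , refl , m≡w
        where
        m≡w : m v ≡ w
        m≡w with T? (K v)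
        ... | yes p′ rewrite T-irrelevant p′ p | eq = refl
        ... | no ¬p = ⊥-elim (¬p p)

    lift : PerfectMatchingOn (FinGraph n E) Lifted
    lift = record { mate = m ; mate-in = m-in ; mate-inv = m-inv ; mate-ne = m-ne ; mate-adj = m-adj }
      where
      m-in : ∀ v → Lifted v → Lifted (m v)
      m-in v (p , s , ≢cv) with partner p ≢cv
      ... | w , q , mate≡ , refl =
        q , subst S mate≡ (mate-in M _ s) , kv≢cv ∘ trans (sym (mate-back M s mate≡))

      m-inv : ∀ v → Lifted v → m (m v) ≡ v
      m-inv v (p , s , ≢cv) with partner p ≢cv
      ... | w , q , mate≡ , refl with partner q (kv≢cv ∘ trans (sym (mate-back M s mate≡)))
      ...   | _ , _ , mate≡′ , m≡v′ =
        trans m≡v′ (sym (kv-injective (trans (sym (mate-back M s mate≡)) mate≡′)))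

      m-ne : ∀ v → Lifted v → ¬ m v ≡ v
      m-ne v (p , s , ≢cv) m≡v with partner p ≢cv
      ... | w , q , mate≡ , m≡w = mate-ne M _ s (trans mate≡ (kv-cong (trans (sym m≡w) m≡v)))

      m-adj : ∀ v → Lifted v → 0 < E v (m v)
      m-adj v (p , s , ≢cv) with partner p ≢cv
      ... | w , q , mate≡ , m≡w =
        subst (λ x → 0 < E v x) (sym m≡w) (subst (Adj C (kv v p)) mate≡ (mate-adj M _ s))

  module _ {R : Pred (Fin n) 0ℓ} (R? : Decidable R) (M : PerfectMatchingOn (FinGraph n E) R) where

    Crossing : Pred (Fin n) 0ℓ
    Crossing u = R u × T (K u) × ¬ T (K (mate M u))

    Pushed : Pred (CVert n K) 0ℓ
    Pushed (inj₁ (v , _)) = R v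
    Pushed (inj₂ _)       = ∃ Crossing

    -- M, with its only edge leaving K redirected to the contracted vertex.
    push : (∀ {u u′} → Crossing u → Crossing u′ → u ≡ u′) → PerfectMatchingOn C Pushed
    push unique = record { mate = m ; mate-in = m-in ; mate-inv = m-inv ; mate-ne = m-ne ; mate-adj = m-adj }
      where
      crossing? : Decidable Crossing
      crossing? u = R? u ×-dec T? (K u) ×-dec ¬? (T? (K (mate M u)))

      toC : Fin n → CVert n K
      toC w with T? (K w)
      ... | yes q = kv w q
      ... | no  _ = cv

      toC-kept : ∀ {w} (q : T (K w)) → toC w ≡ kv w q
      toC-kept {w} q with T? (K w)
      ... | yes q′ = kv-cong refl
      ... | no ¬q  = ⊥-elim (¬q q)

      toC-contracted : ∀ {w} → ¬ T (K w) → toC w ≡ cv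
      toC-contracted {w} ¬q with T? (K w)
      ... | yes q = ⊥-elim (¬q q)
      ... | no  _ = refl

      toC-view : ∀ w → (∃ λ q → toC w ≡ kv w q) ⊎ (¬ T (K w) × toC w ≡ cv)
      toC-view w = view (T? (K w))
        where
        view : Dec (T (K w)) → (∃ λ q → toC w ≡ kv w q) ⊎ (¬ T (K w) × toC w ≡ cv)
        view (yes q) = inj₁ (q , toC-kept q)
        view (no ¬q) = inj₂ (¬q , toC-contracted ¬q)

      crosser : CVert n K
      crosser with any? crossing?
      ... | yes (u , _ , p , _) = kv u p
      ... | no  _               = cv

      crosser≡ : ∀ {u} (c : Crossing u) → crosser ≡ kv u (proj₁ (proj₂ c))
      crosser≡ c with any? crossing?
      ... | yes (u′ , c′) = kv-cong (unique c′ c)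
      ... | no  none      = ⊥-elim (none (_ , c))

      m : CVert n K → CVert n K
      m (inj₁ (v , _)) = toC (mate M v)
      m (inj₂ _)       = crosser

      m-in : ∀ x → Pushed x → Pushed (m x)
      m-in (inj₁ (v , p)) r with toC-view (mate M v)
      ... | inj₁ (q , eq)  = subst Pushed (sym eq) (mate-in M v r)
      ... | inj₂ (¬q , eq) = subst Pushed (sym eq) (v , r , p , ¬q)
      m-in (inj₂ _) (u , c) = subst Pushed (sym (crosser≡ c)) (proj₁ c)

      m-inv : ∀ x → Pushed x → m (m x) ≡ x
      m-inv (inj₁ (v , p)) r with toC-view (mate M v)
      ... | inj₁ (q , eq)  = trans (cong m eq) (trans (cong toC (mate-inv M v r)) (toC-kept p))
      ... | inj₂ (¬q , eq) = trans (cong m eq) (crosser≡ (r , p , ¬q))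
      m-inv (inj₂ _) (u , c@(_ , _ , ¬q)) = trans (cong m (crosser≡ c)) (toC-contracted ¬q)

      m-ne : ∀ x → Pushed x → ¬ m x ≡ x
      m-ne (inj₁ (v , p)) r e with toC-view (mate M v)
      ... | inj₁ (q , eq)  = mate-ne M v r (kv-injective (trans (sym eq) e))
      ... | inj₂ (¬q , eq) = kv≢cv (sym (trans (sym eq) e))
      m-ne (inj₂ _) (u , c) e = kv≢cv (trans (sym (crosser≡ c)) e)

      m-adj : ∀ x → Pushed x → Adj C x (m x)
      m-adj (inj₁ (v , p)) r with toC-view (mate M v)
      ... | inj₁ (q , eq)  = subst (Adj C (kv v p)) (sym eq) (mate-adj M v r)
      ... | inj₂ (¬q , eq) = subst (Adj C (kv v p)) (sym eq) (Adj-cv⁺ {p = p} ¬q (mate-adj M v r))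
      m-adj (inj₂ _) (u , c@(r , p , ¬q)) =
        subst (Adj C cv) (sym (crosser≡ c)) (Adj-cv⁺ {p = p} ¬q (mate-adj M u r))

  module _ {a b : Fin n} {pa : T (K a)} {pb : T (K b)} where

    remaining-kv⁺ : ∀ {v p} → Remaining (FinGraph n E) a b v → Remaining C (kv a pa) (kv b pb) (kv v p)
    remaining-kv⁺ (v≢a , v≢b , ¬av , ¬bv) = v≢a ∘ kv-injective , v≢b ∘ kv-injective , ¬av , ¬bv

    remaining-kv⁻ : ∀ {v p} → Remaining C (kv a pa) (kv b pb) (kv v p) → Remaining (FinGraph n E) a b v
    remaining-kv⁻ (v≢a , v≢b , ¬av , ¬bv) = v≢a ∘ kv-cong , v≢b ∘ kv-cong , ¬av , ¬bv

-- 3-connectivity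

module _ {n : ℕ} {E : Fin n → Fin n → ℕ} {X : Fin n → Bool} where

  walk-crosses : ∀ {S u z} → Reach E S u z → T (X u) → ¬ T (X z) →
                 ∃₂ λ s t → T (X s) × ¬ T (X t) × 0 < E s t × S t
  walk-crosses here                   Xu ¬Xz = ⊥-elim (¬Xz Xu)
  walk-crosses (step {v = v} Sv uv r) Xu ¬Xz with T? (X v)
  ... | yes Xv = walk-crosses r Xv ¬Xz
  ... | no ¬Xv = _ , v , Xu , ¬Xv , uv , Sv

  no-2-separator : ThreeConnected E → ∀ {p q s z} →
                   T (X s) → ¬ s ≡ p → ¬ s ≡ q → ¬ T (X z) → ¬ z ≡ p → ¬ z ≡ q →
                   ∃₂ λ s′ t → T (X s′) × ¬ T (X t) × 0 < E s′ t × ¬ t ≡ p × ¬ t ≡ q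
  no-2-separator (_ , _ , connected) {p} {q} {s} {z} Xs s≢p s≢q ¬Xz z≢p z≢q =
    walk-crosses (connected p q s z (s≢p , s≢q) (z≢p , z≢q)) Xs ¬Xz

-- A tight cut whose shore has one more A-vertex than B-vertices

module TightShore {n : ℕ} (G : CubicBipartite n) (X : Fin n → Bool) where
  open CubicBipartite G using (E; symmetric)
  open CubicBipartiteProperties G
  open Degrees E
  open PerfectMatchingOn

  In Out : Pred (Fin n) 0ℓ
  In  = ⟦ X ⟧
  Out = ∁ In

  In? : Decidable In
  In? = T? ∘ X
  Out? : Decidable Out
  Out? = ∁? In?

  remaining? : ∀ a b → Decidable (Remaining (graphOf G) a b)
  remaining? a b v = ¬? (v ≟ a) ×-dec ¬? (v ≟ b) ×-dec ¬? (0 <? E a v) ×-dec ¬? (0 <? E b v)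

  module _ (tight : TightCut G X) (excess : card (A? ∩? In?) ≡ card (B? ∩? In?) + 1) where

    module Leavers (M : PerfectMatchingOn (graphOf G) U) where

      L? : Decidable (Leaving (mate M) In)
      L? = leaving? (mate M) In?

      leavers : card L? ≡ 1
      leavers = trans (sym (count≡card n (λ v → X v ∧ not (X (mate M v))))) (tight M)

      private
        drop-U : {Z W : Pred (Fin n) 0ℓ} (Z? : Decidable Z) (W? : Decidable W) →
                 card (Z? ∩? U? ∩? W?) ≡ card (Z? ∩? W?)
        drop-U Z? W? = card-≐ (Z? ∩? U? ∩? W?) (Z? ∩? W?)
                              ((λ (z , _ , w) → z , w) , λ (z , w) → z , tt , w)

        leaving-A leaving-B : ℕ
        leaving-A = card (A? ∩? U? ∩? L?)
        leaving-B = card (B? ∩? U? ∩? L?)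

        leaving-total : leaving-A + leaving-B ≡ 1
        leaving-total = begin
          leaving-A + leaving-B               ≡⟨ cong₂ _+_ (drop-U A? L?) (drop-U B? L?) ⟩
          card (A? ∩? L?) + card (B? ∩? L?)   ≡⟨ card-splitˡ L? A? ⟨
          card L?                             ≡⟨ leavers ⟩
          1                                   ∎
          where open ≡-Reasoning

        leaving-difference : leaving-A ≡ suc leaving-B
        leaving-difference = +-cancelˡ-≡ (card (B? ∩? In?)) leaving-A (suc leaving-B) (begin
          card (B? ∩? In?) + leaving-A         ≡⟨ cong (_+ leaving-A) (drop-U B? In?) ⟨
          card (B? ∩? U? ∩? In?) + leaving-A   ≡⟨ matching-balance U? M In? ⟨
          card (A? ∩? U? ∩? In?) + leaving-B   ≡⟨ cong (_+ leaving-B) (drop-U A? In?) ⟩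
          card (A? ∩? In?) + leaving-B         ≡⟨ cong (_+ leaving-B) excess ⟩
          card (B? ∩? In?) + 1 + leaving-B     ≡⟨ +-assoc (card (B? ∩? In?)) 1 leaving-B ⟩
          card (B? ∩? In?) + suc leaving-B     ∎)
          where open ≡-Reasoning

        no-B-leaves : leaving-B ≡ 0
        no-B-leaves = m+n≡0⇒m≡0 leaving-B
                        (suc-injective (trans (cong (_+ leaving-B) (sym leaving-difference)) leaving-total))

      B-stays : ∀ {v} → B v → In v → In (mate M v)
      B-stays {v} Bv Inv with In? (mate M v)
      ... | yes Inm = Inm
      ... | no ¬Inm = ⊥-elim (card≡0⇒∅ (B? ∩? U? ∩? L?) no-B-leaves (Bv , tt , Inv , ¬Inm))

      unique-leaver : ∀ {u u′} → Leaving (mate M) In u → Leaving (mate M) In u′ → u ≡ u′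
      unique-leaver = card≤1⇒unique L? (≤-reflexive leavers)

    cut-edge-from-A : ∀ {v w} → In v → Out w → 0 < E v w → A v
    cut-edge-from-A {v} {w} Inv Outw vw with A? v
    ... | yes Av = Av
    ... | no  Bv = let M , mate-w = edge-in-perfect-matching (B→A Bv vw) (E-sym vw)
                   in ⊥-elim (Outw (subst In (mate-back M tt mate-w) (Leavers.B-stays M Bv Inv)))

    outside-matching : ∀ {u w} → In u → Out w → 0 < E u w →
                       PerfectMatchingOn (graphOf G) (Out ∩ ∁ ｛ w ｝)
    outside-matching {u} {w} Inu Outw uw = restrict M (λ _ → tt) closed
      where
      M = proj₁ (edge-in-perfect-matching (cut-edge-from-A Inu Outw uw) uw)
      mate-u : mate M u ≡ w
      mate-u = proj₂ (edge-in-perfect-matching (cut-edge-from-A Inu Outw uw) uw)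
      closed : ∀ {v} → (Out ∩ ∁ ｛ w ｝) v → (Out ∩ ∁ ｛ w ｝) (mate M v)
      closed {v} (Outv , w≢v) = stays , w≢mate
        where
        stays : Out (mate M v)
        stays Inm = w≢v (trans (sym mate-u) (trans (cong (mate M) u≡mate) (mate-inv M v tt)))
          where
          u≡mate : u ≡ mate M v
          u≡mate = Leavers.unique-leaver M (Inu , Outw ∘ subst In mate-u)
                                           (Inm , Outv ∘ subst In (mate-inv M v tt))
        w≢mate : ¬ w ≡ mate M v
        w≢mate w≡mate = Outv (subst In (trans (sym (mate-back M tt mate-u)) (mate-back M tt (sym w≡mate))) Inu)

    cut-size : sumOver In? (degIn Out?) ≡ 3
    cut-size = begin
      sumOver In? (degIn Out?)  ≡⟨ sumOver-splitˡ In? A? (degIn Out?) ⟩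
      cut-A + cut-B             ≡⟨ cong₂ _+_ cut-A≡3 cut-B≡0 ⟩
      3 + 0                     ∎
      where
      open ≡-Reasoning
      inner-A inner-B cut-A cut-B : ℕ
      inner-A = sumOver (A? ∩? In?) (degIn In?)
      inner-B = sumOver (B? ∩? In?) (degIn In?)
      cut-A   = sumOver (A? ∩? In?) (degIn Out?)
      cut-B   = sumOver (B? ∩? In?) (degIn Out?)
      degrees : {Z : Pred (Fin n) 0ℓ} (Z? : Decidable Z) →
                card (Z? ∩? In?) * 3 ≡ sumOver (Z? ∩? In?) (degIn In?) + sumOver (Z? ∩? In?) (degIn Out?)
      degrees Z? = begin
        card (Z? ∩? In?) * 3                                    ≡⟨ sumOver-const (Z? ∩? In?) 3 ⟨
        sumOver (Z? ∩? In?) (λ _ → 3)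
          ≡⟨ sumOver-cong (Z? ∩? In?) (λ _ → split) ⟩
        sumOver (Z? ∩? In?) (λ v → degIn In? v + degIn Out? v)
          ≡⟨ sumOver-+ (Z? ∩? In?) (degIn In?) (degIn Out?) ⟩
        sumOver (Z? ∩? In?) (degIn In?) + sumOver (Z? ∩? In?) (degIn Out?) ∎
        where
        split : ∀ {v} → 3 ≡ degIn In? v + degIn Out? v
        split {v} = sym (degIn-split In? v)
      cut-B≡0 : cut-B ≡ 0
      cut-B≡0 = trans (sumOver-cong (B? ∩? In?) no-cut)
                      (trans (sumOver-const (B? ∩? In?) 0) (*-zeroʳ (card (B? ∩? In?))))
        where
        no-cut : ∀ {v} → (B ∩ In) v → degIn Out? v ≡ 0
        no-cut (Bv , Inv) = degIn≡0 Out? λ Outw vw → Bv (cut-edge-from-A Inv Outw vw)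
      cut-A≡3 : cut-A ≡ 3
      cut-A≡3 = +-cancelˡ-≡ inner-A cut-A 3 (begin
        inner-A + cut-A                     ≡⟨ degrees A? ⟨
        card (A? ∩? In?) * 3                ≡⟨ cong (_* 3) excess ⟩
        (card (B? ∩? In?) + 1) * 3          ≡⟨ *-distribʳ-+ 3 (card (B? ∩? In?)) 1 ⟩
        card (B? ∩? In?) * 3 + 3            ≡⟨ cong (_+ 3) (degrees B?) ⟩
        inner-B + cut-B + 3                 ≡⟨ cong (λ k → inner-B + k + 3) cut-B≡0 ⟩
        inner-B + 0 + 3                     ≡⟨ cong (_+ 3) (+-identityʳ inner-B) ⟩
        inner-B + 3                         ≡⟨ cong (_+ 3) (bipartite-balance In?) ⟨
        inner-A + 3                         ∎)

    module _ (three-connected : ThreeConnected E) (nontrivial : Nontrivial n X) where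

      -- If y ∈ X̄ had two neighbours in X, then, as |∂(X)| = 3, at most one other vertex q of X̄
      -- would have a neighbour in X; so {y, q} would separate X from the rest of X̄, forcing
      -- X̄ = {y, q}, and then the B-vertex y would send all three of its edges into X.
      private
        module TwoInside {y v v′ : Fin n} (Outy : Out y) (Inv : In v) (Inv′ : In v′)
                         (yv : 0 < E y v) (yv′ : 0 < E y v′) (v≢v′ : ¬ v ≡ v′) where

          attachments : sumOver Out? (degIn In?) ≡ 3
          attachments = trans (edges-sym symmetric Out? In?) cut-size

          others : sumOver (Out? ∩? ∁? (y ≟_)) (degIn In?) ≤ 1
          others = +-cancelˡ-≤ 2 rest 1 (begin
            2 + rest                             ≤⟨ +-monoˡ-≤ rest (+-mono-≤ yv yv′) ⟩
            E y v + E y v′ + rest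
              ≤⟨ +-monoˡ-≤ rest (two-terms≤sumOver In? (E y) v≢v′ Inv Inv′) ⟩
            degIn In? y + rest                   ≡⟨ cong (_+ rest) (sumOver-｛｝ y (degIn In?)) ⟨
            sumOver (y ≟_) (degIn In?) + rest    ≡⟨ cong (_+ rest) at-y ⟨
            sumOver (Out? ∩? (y ≟_)) (degIn In?) + rest ≡⟨ sumOver-split Out? (y ≟_) (degIn In?) ⟨
            sumOver Out? (degIn In?)             ≡⟨ attachments ⟩
            3                                    ∎)
            where
            open ≤-Reasoning
            rest : ℕ
            rest = sumOver (Out? ∩? ∁? (y ≟_)) (degIn In?)
            at-y : sumOver (Out? ∩? (y ≟_)) (degIn In?) ≡ sumOver (y ≟_) (degIn In?)
            at-y = sumOver-≐ (Out? ∩? (y ≟_)) (y ≟_) (proj₂ , λ { refl → Outy , refl }) (degIn In?)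

          By : B y
          By = A→B (cut-edge-from-A Inv Outy (E-sym yv)) (E-sym yv)

          confined : ∀ {q} → Out q → (∀ {z} → Out z → 0 < degIn In? z → y ≡ z ⊎ q ≡ z) →
                     ∀ {z} → Out z → y ≡ z ⊎ q ≡ z
          confined {q} Outq attached {z} Outz with y ≟ z | q ≟ z
          ... | yes y≡z | _       = inj₁ y≡z
          ... | no  _   | yes q≡z = inj₂ q≡z
          ... | no  y≢z | no  q≢z
            with no-2-separator three-connected {p = y} {q = q}
                                Inv (λ { refl → Outy Inv }) (λ { refl → Outq Inv })
                                Outz (y≢z ∘ sym) (q≢z ∘ sym)
          ...   | s , t , Ins , Outt , st , t≢y , t≢q
            with attached Outt (≤-trans (E-sym st) (term≤sumOver In? (E t) Ins))
          ...     | inj₁ y≡t = ⊥-elim (t≢y (sym y≡t))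
          ...     | inj₂ q≡t = ⊥-elim (t≢q (sym q≡t))

          second-attachment-impossible : ∀ {q} → Out q → ¬ y ≡ q → 0 < degIn In? q → Empty.⊥
          second-attachment-impossible {q} Outq y≢q q-attached = 4≰3 (begin
            3 + 1                         ≤⟨ +-mono-≤ (≤-reflexive (sym y-inside)) q-attached ⟩
            degIn In? y + degIn In? q     ≤⟨ two-terms≤sumOver Out? (degIn In?) y≢q Outy Outq ⟩
            sumOver Out? (degIn In?)      ≡⟨ attachments ⟩
            3                             ∎)
            where
            open ≤-Reasoning
            4≰3 : ¬ 4 ≤ 3
            4≰3 (s≤s (s≤s (s≤s ())))
            attached : ∀ {z} → Out z → 0 < degIn In? z → y ≡ z ⊎ q ≡ z
            attached {z} Outz z-attached with y ≟ z
            ... | yes y≡z = inj₁ y≡z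
            ... | no  y≢z = inj₂ (sumOver≤1⇒unique (Out? ∩? ∁? (y ≟_)) (degIn In?) others
                                                    (Outq , y≢q) (Outz , y≢z) q-attached z-attached)
            Bq : B q
            Bq = let u , Inu , qu = sumOver-pos⇒∃ In? (E q) q-attached
                 in A→B (cut-edge-from-A Inu Outq (E-sym qu)) (E-sym qu)
            y-inside : degIn In? y ≡ 3
            y-inside = trans (degIn-≐-on-nbrs In? U? y (λ _ _ → tt) inside) (degIn-U y)
              where
              inside : ∀ {w} → 0 < E y w → U w → In w
              inside {w} yw _ with In? w
              ... | yes Inw  = Inw
              ... | no  Outw with confined Outq attached Outw
              ...   | inj₁ refl = ⊥-elim (By (B→A By yw))
              ...   | inj₂ refl = ⊥-elim (Bq (B→A By yw))

          single-attachment-impossible : (∀ {z} → Out z → ¬ y ≡ z → ¬ 0 < degIn In? z) → Empty.⊥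
          single-attachment-impossible unattached = 2≰1 (begin
            2                    ≤⟨ proj₂ nontrivial ⟩
            count n (not ∘ X)    ≡⟨ count≡card n (not ∘ X) ⟩
            card Out?            ≤⟨ card-mono Out? (y ≟_) ([ id , id ]′ ∘ confined Outy attached) ⟩
            card (y ≟_)          ≡⟨ card-｛｝ y ⟩
            1                    ∎)
            where
            open ≤-Reasoning
            2≰1 : ¬ 2 ≤ 1
            2≰1 (s≤s ())
            attached : ∀ {z} → Out z → 0 < degIn In? z → y ≡ z ⊎ y ≡ z
            attached {z} Outz z-attached with y ≟ z
            ... | yes y≡z = inj₁ y≡z
            ... | no  y≢z = ⊥-elim (unattached Outz y≢z z-attached)

          impossible : Empty.⊥
          impossible with any? (λ z → (Out? ∩? ∁? (y ≟_)) z ×-dec 0 <? degIn In? z)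
          ... | yes (q , (Outq , y≢q) , q-attached) = second-attachment-impossible Outq y≢q q-attached
          ... | no  none = single-attachment-impossible λ Outz y≢z z-attached →
                             none (_ , (Outz , y≢z) , z-attached)

      one-nbr-inside : ∀ {y v v′} → Out y → In v → In v′ → 0 < E y v → 0 < E y v′ → v ≡ v′
      one-nbr-inside {y} {v} {v′} Outy Inv Inv′ yv yv′ with v ≟ v′
      ... | yes v≡v′ = v≡v′
      ... | no  v≢v′ = ⊥-elim (TwoInside.impossible Outy Inv Inv′ yv yv′ v≢v′)

    B-nbrs-inside : ∀ {v w} → B v → In v → 0 < E v w → In w
    B-nbrs-inside {v} {w} Bv Inv vw with In? w
    ... | yes Inw  = Inw
    ... | no  Outw = ⊥-elim (Bv (cut-edge-from-A Inv Outw vw))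

    module Simple (simple : ContractionSimple E X) where

      cut≤1 : ∀ {v} → In v → degIn Out? v ≤ 1
      cut≤1 {v} Inv = subst (_≤ 1) (edgesInto≡degIn (not ∘ X) v) (proj₂ simple v Inv)

      unique-cut-nbr : ∀ {v w w′} → In v → Out w → Out w′ → 0 < E v w → 0 < E v w′ → w ≡ w′
      unique-cut-nbr {v} Inv = sumOver≤1⇒unique Out? (E v) (cut≤1 Inv)

      module PartOne {a b : Fin n} (Aa : A a) (Bb : B b) (Ina : In a) (Inb : In b) where
        open Contraction E X

        Rem : Pred (Fin n) 0ℓ
        Rem = Remaining (graphOf G) a b

        Rem? : Decidable Rem
        Rem? = remaining? a b

        RemC : Pred (CVert n X) 0ℓ
        RemC = Remaining C (kv a Ina) (kv b Inb)

        b-uncut : ¬ Adj C (kv b Inb) cv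
        b-uncut adj = let _ , Outw , bw = Adj-cv⁻ {p = Inb} adj in Outw (B-nbrs-inside Bb Inb bw)

        outside-remaining : ∀ {v} → Out v → ¬ 0 < E a v → Rem v
        outside-remaining Outv ¬av =
          (λ { refl → Outv Ina }) , (λ { refl → Outv Inb }) , ¬av , (λ bv → Outv (B-nbrs-inside Bb Inb bv))

        module Forward (M₁ : NicePair C (kv a Ina) (kv b Inb)) where

          with-cut-edge : ∀ {w} → Out w → 0 < E a w → NicePair (graphOf G) a b
          with-cut-edge {w} Outw aw =
            matching-≐ (⊆Rem , Rem⊆)
                       (union (Out? ∩? ∁? (w ≟_)) disjoint (outside-matching Ina Outw aw) (lift M₁))
            where
            disjoint : (Out ∩ ∁ ｛ w ｝) ⊥ Lifted M₁
            disjoint ((Outv , _) , (Inv , _)) = Outv Inv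
            ⊆Rem : (Out ∩ ∁ ｛ w ｝) ∪ Lifted M₁ ⊆ Rem
            ⊆Rem (inj₁ (Outv , w≢v))  =
              outside-remaining Outv (λ av → w≢v (unique-cut-nbr Ina Outw Outv aw av))
            ⊆Rem (inj₂ (_ , rem , _)) = remaining-kv⁻ rem
            Rem⊆ : Rem ⊆ (Out ∩ ∁ ｛ w ｝) ∪ Lifted M₁
            Rem⊆ {v} rem with In? v
            ... | yes Inv  = inj₂ (Inv , remaining-kv⁺ rem , mate≢cv M₁ cv-deleted (remaining-kv⁺ rem))
              where
              cv-deleted : ¬ RemC cv
              cv-deleted (_ , _ , ¬a-cv , _) = ¬a-cv (Adj-cv⁺ {p = Ina} Outw aw)
            ... | no  Outv = inj₁ (Outv , λ { refl → proj₁ (proj₂ (proj₂ rem)) aw })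

          module WithoutCutEdge (no-cut : ∀ {v} → Out v → ¬ 0 < E a v) where
            cv-remains : RemC cv
            cv-remains = (λ ()) , (λ ()) , a-uncut , b-uncut
              where
              a-uncut : ¬ Adj C (kv a Ina) cv
              a-uncut adj = let _ , Outw , aw = Adj-cv⁻ {p = Ina} adj in no-cut Outw aw

            partner : ∃₂ λ u Inu → mate M₁ cv ≡ kv u Inu
            partner with mate M₁ cv in eq
            ... | inj₁ (u , Inu) = u , Inu , refl
            ... | inj₂ _         = ⊥-elim (mate-ne M₁ cv cv-remains eq)

            u = proj₁ partner
            Inu = proj₁ (proj₂ partner)
            mate-cv : mate M₁ cv ≡ kv u Inu
            mate-cv = proj₂ (proj₂ partner)

            mate-u : ∀ {p} → mate M₁ (kv u p) ≡ cv
            mate-u = trans (cong (mate M₁) (kv-cong refl)) (mate-back M₁ cv-remains mate-cv)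

            cut-of-u : ∃ λ w → Out w × 0 < E u w
            cut-of-u = Adj-cv⁻ {p = Inu} (subst (Adj C cv) mate-cv (mate-adj M₁ cv cv-remains))

            w = proj₁ cut-of-u
            Outw = proj₁ (proj₂ cut-of-u)
            uw = proj₂ (proj₂ cut-of-u)

            u≢w : ¬ u ≡ w
            u≢w u≡w = Outw (subst In u≡w Inu)

            u-remains : Rem u
            u-remains = remaining-kv⁻ (subst RemC mate-cv (mate-in M₁ cv cv-remains))

            disjoint₂ : (｛ u ｝ ∪ ｛ w ｝) ⊥ Lifted M₁
            disjoint₂ (inj₁ refl , _ , _ , ≢cv) = ≢cv mate-u
            disjoint₂ (inj₂ refl , Inw , _)     = Outw Inw

            disjoint₁ : (Out ∩ ∁ ｛ w ｝) ⊥ ((｛ u ｝ ∪ ｛ w ｝) ∪ Lifted M₁)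
            disjoint₁ ((Outv , _)   , inj₁ (inj₁ refl)) = Outv Inu
            disjoint₁ ((_    , w≢v) , inj₁ (inj₂ w≡v))  = w≢v w≡v
            disjoint₁ ((Outv , _)   , inj₂ (Inv , _))   = Outv Inv

            ⊆Rem : (Out ∩ ∁ ｛ w ｝) ∪ ((｛ u ｝ ∪ ｛ w ｝) ∪ Lifted M₁) ⊆ Rem
            ⊆Rem (inj₁ (Outv , _))              = outside-remaining Outv (no-cut Outv)
            ⊆Rem (inj₂ (inj₁ (inj₁ refl)))      = u-remains
            ⊆Rem (inj₂ (inj₁ (inj₂ refl)))      = outside-remaining Outw (no-cut Outw)
            ⊆Rem (inj₂ (inj₂ (_ , rem , _)))    = remaining-kv⁻ rem

            Rem⊆ : Rem ⊆ (Out ∩ ∁ ｛ w ｝) ∪ ((｛ u ｝ ∪ ｛ w ｝) ∪ Lifted M₁)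
            Rem⊆ {v} rem with u ≟ v | w ≟ v | In? v
            ... | yes u≡v | _       | _       = inj₂ (inj₁ (inj₁ u≡v))
            ... | no  _   | yes w≡v | _       = inj₂ (inj₁ (inj₂ w≡v))
            ... | no  u≢v | no  _   | yes Inv = inj₂ (inj₂ (Inv , remaining-kv⁺ rem , not-partner))
              where
              not-partner : ¬ mate M₁ (kv v Inv) ≡ cv
              not-partner mate≡cv = u≢v (sym (kv-injective (trans (sym (mate-inv M₁ _ (remaining-kv⁺ rem)))
                                                               (trans (cong (mate M₁) mate≡cv) mate-cv))))
            ... | no  _   | no  w≢v | no Outv = inj₁ (Outv , w≢v)

            matching : NicePair (graphOf G) a b
            matching = matching-≐ (⊆Rem , Rem⊆)
              (union (Out? ∩? ∁? (w ≟_)) disjoint₁ (outside-matching Inu Outw uw)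
                     (union ((u ≟_) ∪? (w ≟_)) disjoint₂ (edgeMatching _≟_ u≢w uw (E-sym uw))
                            (lift M₁)))

          forward : NicePair (graphOf G) a b
          forward with any? (λ w → Out? w ×-dec 0 <? E a w)
          ... | yes (w , Outw , aw) = with-cut-edge Outw aw
          ... | no  none            = WithoutCutEdge.matching λ Outv av → none (_ , Outv , av)

        private
          Na? : Decidable (λ v → 0 < E a v)
          Na? v = 0 <? E a v
          Nb? : Decidable (λ v → 0 < E b v)
          Nb? v = 0 <? E b v

          not-adjacent : ℕ
          not-adjacent = ind (does (∁? Nb? a))

          degree-b : card Nb? ≡ 3
          degree-b = trans (sum-cong-≗ λ v → trans (*-identityʳ _) (ind-pos (E b v) (simple-b v))) (degree b)
            where
            simple-b : ∀ v → E b v ≤ 1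
            simple-b v with In? v | 0 <? E b v
            ... | yes Inv  | _       = proj₁ simple b v Inb Inv
            ... | no  Outv | yes bv  = ⊥-elim (Outv (B-nbrs-inside Bb Inb bv))
            ... | no  _    | no  ¬bv = ≤-trans (≤-reflexive (n≤0⇒n≡0 (≮⇒≥ ¬bv))) z≤n

          -- The deleted vertices of A ∩ X are a and the neighbours of b; those of B ∩ X are b
          -- and the neighbours of a inside X.
          deleted-A : card ((A? ∩? In?) ∩? ∁? Rem?) ≡ 3 + not-adjacent
          deleted-A = begin
            card ((A? ∩? In?) ∩? ∁? Rem?)
              ≡⟨ card-≐ ((A? ∩? In?) ∩? ∁? Rem?) ((a ≟_) ∪? Nb?) (to , from) ⟩
            card ((a ≟_) ∪? Nb?)      ≡⟨ card-｛｝∪ a Nb? ⟩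
            card Nb? + not-adjacent   ≡⟨ cong (_+ not-adjacent) degree-b ⟩
            3 + not-adjacent          ∎
            where
            open ≡-Reasoning
            to : ∀ {v} → ((A ∩ In) ∩ ∁ Rem) v → (｛ a ｝ ∪ (λ v → 0 < E b v)) v
            to {v} ((Av , _) , ¬rem) with a ≟ v | 0 <? E b v
            ... | yes a≡v | _       = inj₁ a≡v
            ... | no  _   | yes bv  = inj₂ bv
            ... | no  a≢v | no  ¬bv =
              ⊥-elim (¬rem (a≢v ∘ sym , (λ { refl → Bb Av }) , (λ av → A→B Aa av Av) , ¬bv))
            from : ∀ {v} → (｛ a ｝ ∪ (λ v → 0 < E b v)) v → ((A ∩ In) ∩ ∁ Rem) v
            from (inj₁ refl) = (Aa , Ina) , λ (a≢a , _) → a≢a refl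
            from (inj₂ bv)   = (B→A Bb bv , B-nbrs-inside Bb Inb bv) , λ (_ , _ , _ , ¬bv) → ¬bv bv

          deleted-B : card ((B? ∩? In?) ∩? ∁? Rem?) + degIn Out? a ≡ 3 + not-adjacent
          deleted-B = begin
            card ((B? ∩? In?) ∩? ∁? Rem?) + degIn Out? a
              ≡⟨ cong (_+ degIn Out? a) (card-≐ ((B? ∩? In?) ∩? ∁? Rem?) ((b ≟_) ∪? (In? ∩? Na?))
                                                (to , from)) ⟩
            card ((b ≟_) ∪? (In? ∩? Na?)) + degIn Out? a
              ≡⟨ cong (_+ degIn Out? a) (card-｛｝∪ b (In? ∩? Na?)) ⟩
            card (In? ∩? Na?) + ind (does (∁? (In? ∩? Na?) b)) + degIn Out? a
              ≡⟨ xy∙z≈xz∙y (card (In? ∩? Na?)) _ (degIn Out? a) ⟩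
            card (In? ∩? Na?) + degIn Out? a + ind (does (∁? (In? ∩? Na?) b))
              ≡⟨ cong₂ _+_ (trans (cong (_+ degIn Out? a) inner-degree-a) (degIn-split In? a))
                           symmetric-adjacency ⟩
            3 + not-adjacent ∎
            where
            open ≡-Reasoning
            inner-degree-a : card (In? ∩? Na?) ≡ degIn In? a
            inner-degree-a = sum-cong-≗ pointwise
              where
              pointwise : ∀ v → ind (does ((In? ∩? Na?) v)) * 1 ≡ ind (does (In? v)) * E a v
              pointwise v = by-cases (In? v)
                where
                by-cases : (d : Dec (In v)) → ind (does d ∧ does (Na? v)) * 1 ≡ ind (does d) * E a v
                by-cases (yes Inv) = trans (*-identityʳ _) (trans (ind-pos (E a v) (proj₁ simple a v Ina Inv))
                                                                  (sym (+-identityʳ (E a v))))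
                by-cases (no  _)   = refl
            symmetric-adjacency : ind (does (∁? (In? ∩? Na?) b)) ≡ not-adjacent
            symmetric-adjacency = cong ind (does-⇔ (∁? (In? ∩? Na?) b) (∁? Nb? a)
                                                  (λ ¬ab ba → ¬ab (Inb , E-sym ba))
                                                  (λ ¬ba (_ , ab) → ¬ba (E-sym ab)))
            to : ∀ {v} → ((B ∩ In) ∩ ∁ Rem) v → (｛ b ｝ ∪ (In ∩ λ v → 0 < E a v)) v
            to {v} ((Bv , Inv) , ¬rem) with b ≟ v | 0 <? E a v
            ... | yes b≡v | _       = inj₁ b≡v
            ... | no  _   | yes av  = inj₂ (Inv , av)
            ... | no  b≢v | no  ¬av =
              ⊥-elim (¬rem ((λ { refl → Bv Aa }) , b≢v ∘ sym , ¬av , (λ bv → Bv (B→A Bb bv))))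
            from : ∀ {v} → (｛ b ｝ ∪ (In ∩ λ v → 0 < E a v)) v → ((B ∩ In) ∩ ∁ Rem) v
            from (inj₁ refl)       = (Bb , Inb) , λ (_ , b≢b , _) → b≢b refl
            from (inj₂ (Inv , av)) = (A→B Aa av , Inv) , λ (_ , _ , ¬av , _) → ¬av av

        remaining-excess : card (A? ∩? Rem? ∩? In?) + degIn Out? a ≡ card (B? ∩? Rem? ∩? In?) + 1
        remaining-excess = +-cancelʳ-≡ (3 + not-adjacent) (α + ca) (β + 1) (begin
          α + ca + (3 + not-adjacent)           ≡⟨ xy∙z≈xz∙y α ca (3 + not-adjacent) ⟩
          α + (3 + not-adjacent) + ca           ≡⟨ cong (λ k → α + k + ca) deleted-A ⟨
          α + deleted-count A? + ca             ≡⟨ cong (_+ ca) (split A?) ⟨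
          card (A? ∩? In?) + ca                 ≡⟨ cong (_+ ca) excess ⟩
          card (B? ∩? In?) + 1 + ca             ≡⟨ cong (λ k → k + 1 + ca) (split B?) ⟩
          β + deleted-count B? + 1 + ca         ≡⟨ cong (_+ ca) (xy∙z≈xz∙y β (deleted-count B?) 1) ⟩
          β + 1 + deleted-count B? + ca         ≡⟨ +-assoc (β + 1) (deleted-count B?) ca ⟩
          β + 1 + (deleted-count B? + ca)       ≡⟨ cong (β + 1 +_) deleted-B ⟩
          β + 1 + (3 + not-adjacent)            ∎)
          where
          open ≡-Reasoning
          α β ca : ℕ
          α  = card (A? ∩? Rem? ∩? In?)
          β  = card (B? ∩? Rem? ∩? In?)
          ca = degIn Out? a
          deleted-count : {Z : Pred (Fin n) 0ℓ} → Decidable Z → ℕ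
          deleted-count Z? = card ((Z? ∩? In?) ∩? ∁? Rem?)
          split : {Z : Pred (Fin n) 0ℓ} (Z? : Decidable Z) →
                  card (Z? ∩? In?) ≡ card (Z? ∩? Rem? ∩? In?) + deleted-count Z?
          split Z? = trans (card-split (Z? ∩? In?) Rem?)
            (cong (_+ deleted-count Z?) (card-≐ ((Z? ∩? In?) ∩? Rem?) (Z? ∩? Rem? ∩? In?)
                                                ((λ ((z , x) , r) → z , r , x) , (λ (z , r , x) → (z , x) , r))))

        module Backward (M : NicePair (graphOf G) a b) where

          leavers? : Decidable (A ∩ Rem ∩ Leaving (mate M) In)
          leavers? = A? ∩? Rem? ∩? leaving? (mate M) In?

          leaving-A : ℕ
          leaving-A = card leavers?

          crossing-count : leaving-A + degIn Out? a ≡ 1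
          crossing-count = +-cancelˡ-≡ β (leaving-A + degIn Out? a) 1 (begin
            β + (leaving-A + degIn Out? a)     ≡⟨ +-assoc β leaving-A (degIn Out? a) ⟨
            β + leaving-A + degIn Out? a       ≡⟨ cong (_+ degIn Out? a) (matching-balance Rem? M In?) ⟨
            α + leaving-B + degIn Out? a       ≡⟨ cong (λ k → α + k + degIn Out? a) no-B-leaves ⟩
            α + 0 + degIn Out? a               ≡⟨ cong (_+ degIn Out? a) (+-identityʳ α) ⟩
            α + degIn Out? a                   ≡⟨ remaining-excess ⟩
            β + 1                              ∎)
            where
            open ≡-Reasoning
            α β leaving-B : ℕ
            α = card (A? ∩? Rem? ∩? In?)
            β = card (B? ∩? Rem? ∩? In?)
            leaving-B = card (B? ∩? Rem? ∩? leaving? (mate M) In?)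
            no-B-leaves : leaving-B ≡ 0
            no-B-leaves = sumOver-∅ (B? ∩? Rem? ∩? leaving? (mate M) In?)
              (λ { {v} (Bv , rem , Inv , Outm) → Bv (cut-edge-from-A Inv Outm (mate-adj M v rem)) }) (λ _ → 1)

          crossing⇒A : ∀ {u} → Crossing Rem? M u → A u
          crossing⇒A {u} (rem , Inu , Outm) = cut-edge-from-A Inu Outm (mate-adj M u rem)

          crossing-unique : ∀ {u u′} → Crossing Rem? M u → Crossing Rem? M u′ → u ≡ u′
          crossing-unique c@(r , x , o) c′@(r′ , x′ , o′) =
            card≤1⇒unique leavers? (m+n≤o⇒m≤o leaving-A (≤-reflexive crossing-count))
                          (crossing⇒A c , r , x , o) (crossing⇒A c′ , r′ , x′ , o′)

          crossing⇔uncut : ∃ (Crossing Rem? M) ⇔ (¬ Adj C (kv a Ina) cv)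
          crossing⇔uncut = mk⇔ to from
            where
            to : ∃ (Crossing Rem? M) → ¬ Adj C (kv a Ina) cv
            to (u , c@(r , x , o)) adj = 2≰1 (begin
              2                          ≤⟨ +-mono-≤ (card≥1 leavers? {u} (crossing⇒A c , r , x , o))
                                                     a-cut ⟩
              leaving-A + degIn Out? a   ≡⟨ crossing-count ⟩
              1                          ∎)
              where
              open ≤-Reasoning
              2≰1 : ¬ 2 ≤ 1
              2≰1 (s≤s ())
              a-cut : 1 ≤ degIn Out? a
              a-cut = let w , Outw , aw = Adj-cv⁻ {p = Ina} adj in ≤-trans aw (term≤sumOver Out? (E a) Outw)
            from : ¬ Adj C (kv a Ina) cv → ∃ (Crossing Rem? M)
            from ¬adj = let u , _ , r , x , o = card-pos⇒∃ leavers? leaving>0 in u , r , x , o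
              where
              uncut : degIn Out? a ≡ 0
              uncut = degIn≡0 Out? λ Outw aw → ¬adj (Adj-cv⁺ {p = Ina} Outw aw)
              leaving>0 : 0 < leaving-A
              leaving>0 = subst (0 <_) (sym (trans (sym (+-identityʳ leaving-A))
                                                   (trans (cong (leaving-A +_) (sym uncut)) crossing-count)))
                                z<s

          backward : NicePair C (kv a Ina) (kv b Inb)
          backward = matching-≐ (⊆RemC , RemC⊆) (push Rem? M crossing-unique)
            where
            ⊆RemC : Pushed Rem? M ⊆ RemC
            ⊆RemC {inj₁ _} rem      = remaining-kv⁺ rem
            ⊆RemC {inj₂ _} crossing = (λ ()) , (λ ()) , Equivalence.to crossing⇔uncut crossing , b-uncut
            RemC⊆ : RemC ⊆ Pushed Rem? M
            RemC⊆ {inj₁ _} rem                = remaining-kv⁻ rem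
            RemC⊆ {inj₂ _} (_ , _ , ¬adj , _) = Equivalence.from crossing⇔uncut ¬adj

        part-i : NicePair C (kv a Ina) (kv b Inb) ⇔ NicePair (graphOf G) a b
        part-i = mk⇔ Forward.forward Backward.backward

      module PartTwo (three-connected : ThreeConnected E) (nontrivial : Nontrivial n X)
                     {a b : Fin n} (Aa : A a) (Bb : B b) (Ina : In a) (notXb : T (not (X b))) where
        module C₁ = Contraction E X
        module C₂ = Contraction E (not ∘ X)

        Outb : Out b
        Outb = T-not⇒¬T notXb

        Rem : Pred (Fin n) 0ℓ
        Rem = Remaining (graphOf G) a b

        Inner Outer Across : Pred (Fin n) 0ℓ
        Inner v  = In v × Rem v × ¬ 0 < degIn Out? v
        Outer v  = Out v × Rem v × ¬ 0 < degIn In? v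
        Across v = Rem v × ((In v × 0 < degIn Out? v) ⊎ (Out v × 0 < degIn In? v))

        inner-matching : NicePair C₁.C (kv a Ina) cv → PerfectMatchingOn (graphOf G) Inner
        inner-matching M₁ = matching-≐ (to , from) (C₁.lift M₁)
          where
          to : C₁.Lifted M₁ ⊆ Inner
          to (Inv , (v≢a , _ , ¬av , ¬cut) , _) =
            Inv , (v≢a ∘ C₁.kv-cong , (λ { refl → Outb Inv }) , ¬av ,
                   ¬cut ∘ C₁.Adj-cv⁺ {p = Inv} Outb ∘ E-sym)
                , ¬cut ∘ C₁.⇒Adj-cv {p = Inv}
          from : Inner ⊆ C₁.Lifted M₁
          from {v} (Inv , (v≢a , _ , ¬av , _) , ¬cut) =
            Inv , rem , C₁.mate≢cv M₁ (λ (_ , cv≢cv , _) → cv≢cv refl) rem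
            where
            rem : Remaining C₁.C (kv a Ina) cv (kv v Inv)
            rem = v≢a ∘ C₁.kv-injective , (λ ()) , ¬av , ¬cut ∘ C₁.Adj-cv⇒ {p = Inv}

        outer-matching : NicePair C₂.C cv (kv b notXb) → PerfectMatchingOn (graphOf G) Outer
        outer-matching M₂ = matching-≐ (to , from) (C₂.lift M₂)
          where
          inner-degree : ∀ {v} → degIn (∁? (T? ∘ (not ∘ X))) v ≡ degIn In? v
          inner-degree {v} = sum-cong-≗ λ w → cong (λ x → ind x * E v w) (not-involutive (X w))
          to : C₂.Lifted M₂ ⊆ Outer
          to {v} (notXv , (_ , v≢b , ¬attached , ¬bv) , _) =
            T-not⇒¬T notXv , ((λ { refl → T-not⇒¬T notXv Ina }) , v≢b ∘ C₂.kv-cong , ¬av , ¬bv)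
                           , ¬attached ∘ C₂.⇒Adj-cv {p = notXv} ∘ subst (0 <_) (sym inner-degree)
            where
            ¬av : ¬ 0 < E a v
            ¬av av = ¬attached (C₂.Adj-cv⁺ {p = notXv} (T⇒¬T-not Ina) (E-sym av))
          from : Outer ⊆ C₂.Lifted M₂
          from {v} (Outv , (_ , v≢b , _ , ¬bv) , ¬attached) =
            ¬T⇒T-not Outv , rem , C₂.mate≢cv M₂ (λ (cv≢cv , _) → cv≢cv refl) rem
            where
            rem : Remaining C₂.C cv (kv b notXb) (kv v (¬T⇒T-not Outv))
            rem = (λ ()) , v≢b ∘ C₂.kv-injective
                , ¬attached ∘ subst (0 <_) inner-degree ∘ C₂.Adj-cv⇒ {p = ¬T⇒T-not Outv} , ¬bv

        across : Fin n → Fin n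
        across v with In? v
        ... | yes _ = someNbrIn Out? v
        ... | no  _ = someNbrIn In? v

        across-in : ∀ {v} → In v → across v ≡ someNbrIn Out? v
        across-in {v} Inv with In? v
        ... | yes _    = refl
        ... | no  Outv = ⊥-elim (Outv Inv)

        across-out : ∀ {v} → Out v → across v ≡ someNbrIn In? v
        across-out {v} Outv with In? v
        ... | yes Inv = ⊥-elim (Outv Inv)
        ... | no  _   = refl

        from-inside : ∀ {v} → Rem v → In v → 0 < degIn Out? v →
                      Across (someNbrIn Out? v) × across (someNbrIn Out? v) ≡ v × 0 < E v (someNbrIn Out? v)
        from-inside {v} (v≢a , v≢b , ¬av , ¬bv) Inv cut =
          (rem-w , inj₂ (Outw , w-attached)) , trans (across-out Outw) back , vw
          where
          w = someNbrIn Out? v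
          Outw = proj₁ (someNbrIn-spec Out? cut)
          vw = proj₂ (someNbrIn-spec Out? cut)
          w-attached : 0 < degIn In? w
          w-attached = ≤-trans (E-sym vw) (term≤sumOver In? (E w) Inv)
          back : someNbrIn In? w ≡ v
          back = one-nbr-inside three-connected nontrivial Outw (proj₁ (someNbrIn-spec In? w-attached)) Inv
                                (proj₂ (someNbrIn-spec In? w-attached)) (E-sym vw)
          rem-w : Rem w
          rem-w = (λ w≡a → Outw (subst In (sym w≡a) Ina))
                , (λ w≡b → ¬bv (subst (λ x → 0 < E x v) w≡b (E-sym vw)))
                , (λ aw → v≢a (sym (one-nbr-inside three-connected nontrivial Outw Ina Inv (E-sym aw) (E-sym vw))))
                , (λ bw → A→B (cut-edge-from-A Inv Outw vw) vw (B→A Bb bw))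

        from-outside : ∀ {v} → Rem v → Out v → 0 < degIn In? v →
                       Across (someNbrIn In? v) × across (someNbrIn In? v) ≡ v × 0 < E v (someNbrIn In? v)
        from-outside {v} (v≢a , v≢b , ¬av , ¬bv) Outv attached =
          (rem-u , inj₁ (Inu , u-cut)) , trans (across-in Inu) back , vu
          where
          u = someNbrIn In? v
          Inu = proj₁ (someNbrIn-spec In? attached)
          vu = proj₂ (someNbrIn-spec In? attached)
          u-cut : 0 < degIn Out? u
          u-cut = ≤-trans (E-sym vu) (term≤sumOver Out? (E u) Outv)
          back : someNbrIn Out? u ≡ v
          back = unique-cut-nbr Inu (proj₁ (someNbrIn-spec Out? u-cut)) Outv
                                    (proj₂ (someNbrIn-spec Out? u-cut)) (E-sym vu)
          rem-u : Rem u
          rem-u = (λ u≡a → ¬av (subst (λ x → 0 < E x v) u≡a (E-sym vu)))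
                , (λ u≡b → Outb (subst In u≡b Inu))
                , (λ au → A→B Aa au (cut-edge-from-A Inu Outv (E-sym vu)))
                , (λ bu → v≢b (sym (unique-cut-nbr Inu Outb Outv (E-sym bu) (E-sym vu))))

        across-step : ∀ {v} → Across v →
                      Across (across v) × across (across v) ≡ v × 0 < E v (across v)
        across-step (rem , inj₁ (Inv , cut))       rewrite across-in Inv   = from-inside rem Inv cut
        across-step (rem , inj₂ (Outv , attached)) rewrite across-out Outv = from-outside rem Outv attached

        cross-matching : PerfectMatchingOn (graphOf G) Across
        cross-matching = record
          { mate     = across
          ; mate-in  = λ _ c → proj₁ (across-step c)
          ; mate-inv = λ _ c → proj₁ (proj₂ (across-step c))
          ; mate-ne  = λ v c e → no-loop (subst (λ x → 0 < E v x) e (proj₂ (proj₂ (across-step c))))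
          ; mate-adj = λ _ c → proj₂ (proj₂ (across-step c))
          }

        part-ii : NicePair C₁.C (kv a Ina) cv → NicePair C₂.C cv (kv b notXb) → NicePair (graphOf G) a b
        part-ii M₁ M₂ = matching-≐ (⊆Rem , Rem⊆)
          (union Inner? disjoint₁ (inner-matching M₁)
                 (union Outer? disjoint₂ (outer-matching M₂) cross-matching))
          where
          Inner? : Decidable Inner
          Inner? = In? ∩? remaining? a b ∩? ∁? (λ v → 0 <? degIn Out? v)
          Outer? : Decidable Outer
          Outer? = Out? ∩? remaining? a b ∩? ∁? (λ v → 0 <? degIn In? v)
          disjoint₁ : Inner ⊥ (Outer ∪ Across)
          disjoint₁ ((Inv , _)      , inj₁ (Outv , _))               = Outv Inv
          disjoint₁ ((_ , _ , ¬cut) , inj₂ (_ , inj₁ (_ , cut)))     = ¬cut cut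
          disjoint₁ ((Inv , _)      , inj₂ (_ , inj₂ (Outv , _)))    = Outv Inv
          disjoint₂ : Outer ⊥ Across
          disjoint₂ ((Outv , _)          , (_ , inj₁ (Inv , _)))      = Outv Inv
          disjoint₂ ((_ , _ , ¬attached) , (_ , inj₂ (_ , attached))) = ¬attached attached
          ⊆Rem : Inner ∪ (Outer ∪ Across) ⊆ Rem
          ⊆Rem (inj₁ (_ , rem , _))         = rem
          ⊆Rem (inj₂ (inj₁ (_ , rem , _)))  = rem
          ⊆Rem (inj₂ (inj₂ (rem , _)))      = rem
          Rem⊆ : Rem ⊆ Inner ∪ (Outer ∪ Across)
          Rem⊆ {v} rem = cases (In? v) (0 <? degIn Out? v) (0 <? degIn In? v)
            where
            cases : Dec (In v) → Dec (0 < degIn Out? v) → Dec (0 < degIn In? v) →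
                    (Inner ∪ (Outer ∪ Across)) v
            cases (yes Inv)  (yes cut) _              = inj₂ (inj₂ (rem , inj₁ (Inv , cut)))
            cases (yes Inv)  (no ¬cut) _              = inj₁ (Inv , rem , ¬cut)
            cases (no  Outv) _         (yes attached) = inj₂ (inj₂ (rem , inj₂ (Outv , attached)))
            cases (no  Outv) _         (no ¬attached) = inj₂ (inj₁ (Outv , rem , ¬attached))

lemma4p5 : {n : ℕ} (G : CubicBipartite n) (X : Fin n → Bool) →
    let E = CubicBipartite.E G
        A = CubicBipartite.side G
    in TightCut G X → Nontrivial n X →
       count n (λ v → A v ∧ X v) ≡ count n (λ v → not (A v) ∧ X v) + 1 →
       ContractionSimple E X →
       (a b : Fin n) → T (A a) → T (not (A b)) →
       ((ha : T (X a)) (hb : T (X b)) →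
          NicePair (contractKeep E X) (kv a ha) (kv b hb) ⇔ NicePair (graphOf G) a b)
       ×
       (ThreeConnected E → (ha : T (X a)) (hb : T (not (X b))) →
          NicePair (contractKeep E X) (kv a ha) cv →
          NicePair (contractKeep E (λ v → not (X v))) cv (kv b hb) →
          NicePair (graphOf G) a b)
lemma4p5 {n} G X tight nontrivial more-A simple a b Aa notAb =
    (λ Ina Inb → PartOne.part-i Aa Bb Ina Inb)
  , (λ three-connected Ina notXb → PartTwo.part-ii three-connected nontrivial Aa Bb Ina notXb)
  where
  open TightShore G X
  open CubicBipartiteProperties G using (A?; B?)

  Bb : ¬ T (CubicBipartite.side G b)
  Bb = T-not⇒¬T notAb

  excess : card (A? ∩? In?) ≡ card (B? ∩? In?) + 1
  excess = trans (sym (count≡card n _)) (trans more-A (cong (_+ 1) (count≡card n _)))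

  open Simple tight excess simple
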